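{- The number of $\pi\in\mathrm{PF}_n$ with $\pi_1=j$ and $N_1(\pi)=k$ is \begin{equation*} f_n(j,k)=\sum_{\ell=j}^n\binom{n-1}{\ell-1} \binom{\ell-2}{k-1}(\ell-1)^{\ell-1-k} \cdot (n-\ell+1)^{n-\ell-1}. \end{equation*}
   Context: A (classical) parking function of length $n$ is a sequence $\pi=(\pi_1,\dots,\pi_n)$ of positive integers whose increasing rearrangement $\lambda$ satisfies $\lambda_i\le i$; $\mathrm{PF}_n$ denotes the set of such. $N_1(\pi)$ is the number of ones in $\pi$, and $f_n(j,k)=|\{\pi\in\mathrm{PF}_n:\pi_1=j,\ N_1(\pi)=k\}|$. Here $j\in\{2,\dots,n\}$ and $k\in\{1,\dots,n-1\}$. -}

module Defs where

open import Data.Nat using (ℕ; zero; suc; _+_; _*_; _∸_; _^_; _≤_; _≟_)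
open import Data.Nat.Properties using (≤-decTotalOrder)
open import Data.Nat.Combinatorics using (_C_)
open import Data.List using (List; []; _∷_)
open import Data.Vec using (Vec; []; _∷_; toList; count)
open import Data.Empty using (⊥)
open import Data.Product using (Σ; _×_)
open import Relation.Binary.PropositionalEquality using (_≡_)
open import Data.List.Sort.InsertionSort.Base ≤-decTotalOrder using (sort)

incRearr : ∀ {n} → Vec ℕ n → List ℕ
incRearr π = sort (toList π)

data BoundedFrom : ℕ → List ℕ → Set where
  []  : ∀ {i} → BoundedFrom i []
  _∷_ : ∀ {i x xs} → (1 ≤ x × x ≤ i) → BoundedFrom (suc i) xs → BoundedFrom i (x ∷ xs)

-- π is a parking function: a sequence of positive integers whose
-- increasing rearrangement λ satisfies λ_i ≤ i (1-indexed)
IsPF : ∀ {n} → Vec ℕ n → Set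
IsPF π = BoundedFrom 1 (incRearr π)

FirstIs : ∀ {n} → Vec ℕ n → ℕ → Set
FirstIs []      j = ⊥
FirstIs (x ∷ _) j = x ≡ j

N₁ : ∀ {n} → Vec ℕ n → ℕ
N₁ π = count (_≟ 1) π

PFjk : ℕ → ℕ → ℕ → Set
PFjk n j k = Σ (Vec ℕ n) (λ π → IsPF π × FirstIs π j × N₁ π ≡ k)

sumFromTo : ℕ → ℕ → (ℕ → ℕ) → ℕ
sumFromTo a b f = go (suc b ∸ a) a
  where
  go : ℕ → ℕ → ℕ
  go zero    ℓ = 0
  go (suc m) ℓ = f ℓ + go m (suc ℓ)

-- right-hand side of the formula; ∸ is truncated subtraction, only
-- used where the real exponents are ≥ 0 or the term is killed by the
-- binomial factor
formula : ℕ → ℕ → ℕ → ℕ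
formula n j k = sumFromTo j n (λ ℓ →
  ((n ∸ 1) C (ℓ ∸ 1)) * ((ℓ ∸ 2) C (k ∸ 1)) * (ℓ ∸ 1) ^ (ℓ ∸ 1 ∸ k)
    * (n ∸ ℓ + 1) ^ (n ∸ ℓ ∸ 1))

module Submission where

-- Write π = j ∷ a.  A positive sequence is a parking function iff, for every
-- t ≤ n, at least t of its entries are ≤ t; sorting does not change these counts.
-- If j ∷ a parks, the first t at which a alone has fewer than t entries ≤ t is a
-- spot ℓ ≥ j that a leaves empty: the ℓ − 1 entries of a that are ≤ ℓ form a
-- parking function containing all the ones, the other n − ℓ entries lowered by ℓ
-- form a parking function, and conversely this splitting determines ℓ and makes
-- j ∷ a park.  Choosing the positions of the first block gives (n−1 choose ℓ−1).
-- Both blocks are counted through y-parking words (y − 1 ones in front make a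
-- parking function): deleting the r ones of a (y+1)-parking word and lowering
-- the rest leaves a (y+r)-parking word, so by Abel's identity
--   Σ_r (m choose r) (z+r)(z+m)^(m−r−1) = (z+1)(z+m+1)^(m−1)   (the r = m term read as 1)
-- there are y (y+m)^(m−1) of length m; fixing the number of ones then gives
-- (ℓ−2 choose k−1) (ℓ−1)^(ℓ−1−k) and (n−ℓ+1)^(n−ℓ−1).

open import Data.Bool using (Bool; true; false; T; not; _∧_)
open import Data.Bool.ListAction using (all)
open import Data.Bool.Properties using (T-∧; T-irrelevant)
open import Data.Empty using (⊥-elim)
open import Data.Fin using (Fin)
open import Data.Fin.Properties using (0↔⊥; 1↔⊤; +↔⊎)
open import Data.List using (List; []; _∷_; _++_; length; map; filterᵇ)
open import Data.List.Membership.Propositional using (_∈_)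
open import Data.List.Membership.Propositional.Properties using (∈-filter⁻)
open import Data.List.Properties
  using (length-map; length-filter; map-id; map-∘; map-cong; ++-identityʳ;
         filter-++; filter-all; filter-none; filter-accept; filter-reject)
open import Data.List.Relation.Binary.Permutation.Propositional using (_↭_; ↭-sym)
open import Data.List.Relation.Binary.Permutation.Propositional.Properties
  using (↭-length; filter-↭; All-resp-↭)
open import Data.List.Relation.Unary.All as All using (All; []; _∷_)
open import Data.List.Relation.Unary.All.Properties using (all⁺; all⁻)
open import Data.List.Relation.Unary.AllPairs using (AllPairs; _∷_)
open import Data.List.Relation.Unary.Any using (here; there)
open import Data.List.Relation.Unary.Linked.Properties using (Linked⇒AllPairs)
open import Data.Nat
  using (ℕ; zero; suc; pred; _+_; _*_; _^_; _∸_; _≤_; _<_; _≡ᵇ_; _≤ᵇ_;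
         z≤n; s≤s; s≤s⁻¹; s<s; s<s⁻¹; NonZero)
open import Data.Nat.Combinatorics using (_C_; nC1≡n; nCk+nC[k+1]≡[n+1]C[k+1])
open import Data.Nat.Combinatorics.Specification using (k>n⇒nCk≡0)
open import Data.Nat.Properties
open import Data.Nat.Tactic.RingSolver using (solve-∀)
open import Algebra.Properties.CommutativeSemigroup +-commutativeSemigroup
  using () renaming (interchange to +-interchange; x∙yz≈y∙xz to x+[y+z]≡y+[x+z])
open import Algebra.Properties.CommutativeSemigroup *-commutativeSemigroup
  using () renaming (x∙yz≈y∙xz to x*[y*z]≡y*[x*z])
open import Data.List.Sort.InsertionSort.Base ≤-decTotalOrder using (sort)
open import Data.List.Sort.InsertionSort.Properties ≤-decTotalOrder using (sort-↭; sort-↗)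
open import Data.Product using (Σ; ∃; _×_; _,_; proj₁; proj₂)
open import Data.Sum using (_⊎_; inj₁; inj₂; [_,_]′)
open import Data.Sum.Function.Propositional using (_⊎-↔_)
open import Data.Unit using (tt)
open import Data.Vec using (Vec; []; _∷_; toList; count)
open import Data.Vec.Properties using (length-toList)
open import Function using (_∘_; case_of_)
open import Function.Bundles using (_↔_; _⇔_; mk⇔; mk↔ₛ′; Equivalence)
open import Function.Properties.Inverse using (↔-sym; ↔-trans)
open import Relation.Binary.Definitions using (tri<; tri≈; tri>)
open import Relation.Binary.PropositionalEquality
open import Relation.Nullary using (¬_; yes; no)
open import Relation.Nullary.Decidable using (T?; map′; ⌊_⌋; toWitness; fromWitness)
open import Relation.Unary using (Decidable)

open import Defs

𝟙 : Bool → ℕ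
𝟙 true  = 1
𝟙 false = 0

𝟙-true : ∀ {b} → T b → 𝟙 b ≡ 1
𝟙-true {true} _ = refl

𝟙-false : ∀ {b} → ¬ T b → 𝟙 b ≡ 0
𝟙-false {true}  ¬b = ⊥-elim (¬b tt)
𝟙-false {false} _  = refl

𝟙-cong : ∀ {b c} → T b ⇔ T c → 𝟙 b ≡ 𝟙 c
𝟙-cong {true}  {true}  _   = refl
𝟙-cong {true}  {false} b⇔c = ⊥-elim (Equivalence.to b⇔c tt)
𝟙-cong {false} {true}  b⇔c = ⊥-elim (Equivalence.from b⇔c tt)
𝟙-cong {false} {false} _   = refl

𝟙-∧ : ∀ b c → 𝟙 (b ∧ c) ≡ 𝟙 b * 𝟙 c
𝟙-∧ true  c = sym (+-identityʳ (𝟙 c))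
𝟙-∧ false c = refl

private
  T-not : ∀ {b} → ¬ T b → T (not b)
  T-not {false} _  = tt
  T-not {true}  ¬b = ¬b tt

  ¬T-not : ∀ {b} → T b → ¬ T (not b)
  ¬T-not {true} _ ()

  ≤ᵇ-above : ∀ {t x} → t < x → ¬ T (x ≤ᵇ t)
  ≤ᵇ-above {t} {x} t<x x≤ᵇt = <⇒≱ t<x (≤ᵇ⇒≤ x t x≤ᵇt)

-- Binomial sums and Abel's identity

binomial : ℕ → ℕ → ℕ
binomial n       zero    = 1
binomial zero    (suc k) = 0
binomial (suc n) (suc k) = binomial n k + binomial n (suc k)

binomial≡C : ∀ n k → binomial n k ≡ n C k
binomial≡C n       zero    = refl
binomial≡C zero    (suc k) = sym (k>n⇒nCk≡0 {0} {suc k} (s≤s z≤n))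
binomial≡C (suc n) (suc k) =
  trans (cong₂ _+_ (binomial≡C n k) (binomial≡C n (suc k))) (nCk+nC[k+1]≡[n+1]C[k+1] n k)

binomial-vanishes : ∀ {n k} → n < k → binomial n k ≡ 0
binomial-vanishes {zero}  {suc k} _         = refl
binomial-vanishes {suc n} {suc k} (s≤s n<k) =
  cong₂ _+_ (binomial-vanishes n<k) (binomial-vanishes (m<n⇒m<1+n n<k))

binomial-diag : ∀ n → binomial n n ≡ 1
binomial-diag zero    = refl
binomial-diag (suc n) = cong₂ _+_ (binomial-diag n) (binomial-vanishes (n<1+n n))

binomial-absorb : ∀ m k → binomial (suc m) (suc k) * suc k ≡ binomial m k * suc m
binomial-absorb m       zero    =
  trans (*-identityʳ _) (trans (binomial≡C (suc m) 1) (trans (nC1≡n (suc m)) (sym (*-identityˡ _))))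
binomial-absorb zero    (suc k) = refl
binomial-absorb (suc m) (suc k) = begin
  (a + b) * suc (suc k)
    ≡⟨ regroup a b (suc k) ⟩
  a * suc k + a + b * suc (suc k)
    ≡⟨ cong₂ (λ x y → x + a + y) (binomial-absorb m k) (binomial-absorb m (suc k)) ⟩
  binomial m k * suc m + a + binomial m (suc k) * suc m
    ≡⟨ regroup′ (binomial m k) (binomial m (suc k)) (suc m) ⟩
  a * suc (suc m) ∎
  where
  open ≡-Reasoning
  a = binomial (suc m) (suc k)
  b = binomial (suc m) (suc (suc k))
  regroup : ∀ a b k → (a + b) * suc k ≡ a * k + a + b * suc k
  regroup = solve-∀
  regroup′ : ∀ c d m → c * m + (c + d) + d * m ≡ (c + d) * suc m
  regroup′ = solve-∀

-- The sum of g (number of ones) (number of zeros) over the binary words of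
-- length m, that is Σ_{r+s=m} (m choose r) g r s (binomialSum-select).
binomialSum : ℕ → (ℕ → ℕ → ℕ) → ℕ
binomialSum zero    g = g 0 0
binomialSum (suc m) g = binomialSum m (λ r s → g r (suc s) + g (suc r) s)

binomialSum-cong : ∀ m {g h : ℕ → ℕ → ℕ} → (∀ r s → r + s ≡ m → g r s ≡ h r s) →
                   binomialSum m g ≡ binomialSum m h
binomialSum-cong zero    g≡h = g≡h 0 0 refl
binomialSum-cong (suc m) g≡h = binomialSum-cong m λ r s r+s≡m →
  cong₂ _+_ (g≡h r (suc s) (trans (+-suc r s) (cong suc r+s≡m))) (g≡h (suc r) s (cong suc r+s≡m))

binomialSum-+ : ∀ m (g h : ℕ → ℕ → ℕ) →
                binomialSum m (λ r s → g r s + h r s) ≡ binomialSum m g + binomialSum m h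
binomialSum-+ zero    g h = refl
binomialSum-+ (suc m) g h = trans
  (binomialSum-cong m (λ r s _ → +-interchange (g r (suc s)) (h r (suc s)) (g (suc r) s) (h (suc r) s)))
  (binomialSum-+ m (λ r s → g r (suc s) + g (suc r) s) (λ r s → h r (suc s) + h (suc r) s))

binomialSum-* : ∀ m c (g : ℕ → ℕ → ℕ) → binomialSum m (λ r s → c * g r s) ≡ c * binomialSum m g
binomialSum-* zero    c g = refl
binomialSum-* (suc m) c g = trans
  (binomialSum-cong m (λ r s _ → sym (*-distribˡ-+ c (g r (suc s)) (g (suc r) s))))
  (binomialSum-* m c (λ r s → g r (suc s) + g (suc r) s))

binomialSum-select : ∀ m c (g : ℕ → ℕ → ℕ) →
                     binomialSum m (λ r s → 𝟙 (r ≡ᵇ c) * g r s) ≡ binomial m c * g c (m ∸ c)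
binomialSum-select zero    zero    g = refl
binomialSum-select zero    (suc c) g = refl
binomialSum-select (suc m) zero    g =
  trans (binomialSum-cong m (λ r s _ → +-identityʳ _))
        (binomialSum-select m zero (λ r s → g r (suc s)))
binomialSum-select (suc m) (suc c) g = begin
  binomialSum m (λ r s → 𝟙 (r ≡ᵇ suc c) * g r (suc s) + 𝟙 (r ≡ᵇ c) * g (suc r) s)
    ≡⟨ binomialSum-+ m _ _ ⟩
  binomialSum m (λ r s → 𝟙 (r ≡ᵇ suc c) * g r (suc s)) +
  binomialSum m (λ r s → 𝟙 (r ≡ᵇ c) * g (suc r) s)
    ≡⟨ cong₂ _+_ (binomialSum-select m (suc c) (λ r s → g r (suc s)))
                 (binomialSum-select m c (λ r s → g (suc r) s)) ⟩
  binomial m (suc c) * g (suc c) (suc (m ∸ suc c)) + binomial m c * g (suc c) (m ∸ c)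
    ≡⟨ cong (_+ binomial m c * g (suc c) (m ∸ c)) upper-term ⟩
  binomial m (suc c) * g (suc c) (m ∸ c) + binomial m c * g (suc c) (m ∸ c)
    ≡⟨ +-comm (binomial m (suc c) * g (suc c) (m ∸ c)) _ ⟩
  binomial m c * g (suc c) (m ∸ c) + binomial m (suc c) * g (suc c) (m ∸ c)
    ≡⟨ *-distribʳ-+ (g (suc c) (m ∸ c)) (binomial m c) (binomial m (suc c)) ⟨
  (binomial m c + binomial m (suc c)) * g (suc c) (m ∸ c) ∎
  where
  open ≡-Reasoning
  upper-term : binomial m (suc c) * g (suc c) (suc (m ∸ suc c)) ≡
               binomial m (suc c) * g (suc c) (m ∸ c)
  upper-term with c <? m
  ... | yes c<m = cong (λ s → binomial m (suc c) * g (suc c) s) (sym (+-∸-assoc 1 c<m))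
  ... | no  c≮m rewrite binomial-vanishes (s≤s (≮⇒≥ c≮m)) = refl

binomial-theorem : ∀ m Y → binomialSum m (λ _ s → Y ^ s) ≡ suc Y ^ m
binomial-theorem zero    Y = refl
binomial-theorem (suc m) Y = begin
  binomialSum m (λ _ s → Y ^ suc s + Y ^ s) ≡⟨ binomialSum-cong m (λ _ s _ → +-comm (Y ^ suc s) (Y ^ s)) ⟩
  binomialSum m (λ _ s → suc Y * Y ^ s)     ≡⟨ binomialSum-* m (suc Y) (λ _ s → Y ^ s) ⟩
  suc Y * binomialSum m (λ _ s → Y ^ s)     ≡⟨ cong (suc Y *_) (binomial-theorem m Y) ⟩
  suc Y ^ suc m                             ∎
  where open ≡-Reasoning

binomialSum-ones : ∀ m Y → binomialSum m (λ r s → r * Y ^ s) * suc Y ≡ m * suc Y ^ m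
binomialSum-ones zero    Y = refl
binomialSum-ones (suc m) Y = begin
  binomialSum m (λ r s → r * Y ^ suc s + suc r * Y ^ s) * suc Y
    ≡⟨ cong (_* suc Y) (binomialSum-cong m (λ r s _ → split Y r (Y ^ s))) ⟩
  binomialSum m (λ r s → suc Y * (r * Y ^ s) + Y ^ s) * suc Y
    ≡⟨ cong (_* suc Y) (binomialSum-+ m (λ r s → suc Y * (r * Y ^ s)) (λ _ s → Y ^ s)) ⟩
  (binomialSum m (λ r s → suc Y * (r * Y ^ s)) + binomialSum m (λ _ s → Y ^ s)) * suc Y
    ≡⟨ cong₂ (λ a b → (a + b) * suc Y) (binomialSum-* m (suc Y) (λ r s → r * Y ^ s))
                                       (binomial-theorem m Y) ⟩
  (suc Y * binomialSum m (λ r s → r * Y ^ s) + suc Y ^ m) * suc Y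
    ≡⟨ regroup Y (binomialSum m (λ r s → r * Y ^ s)) (suc Y ^ m) ⟩
  suc Y * (binomialSum m (λ r s → r * Y ^ s) * suc Y) + suc Y ^ m * suc Y
    ≡⟨ cong (λ a → suc Y * a + suc Y ^ m * suc Y) (binomialSum-ones m Y) ⟩
  suc Y * (m * suc Y ^ m) + suc Y ^ m * suc Y
    ≡⟨ collect Y m (suc Y ^ m) ⟩
  suc m * suc Y ^ suc m ∎
  where
  open ≡-Reasoning
  split : ∀ Y r A → r * (Y * A) + suc r * A ≡ suc Y * (r * A) + A
  split = solve-∀
  regroup : ∀ Y P A → (suc Y * P + A) * suc Y ≡ suc Y * (P * suc Y) + A * suc Y
  regroup = solve-∀
  collect : ∀ Y m A → suc Y * (m * A) + A * suc Y ≡ suc m * (suc Y * A)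
  collect = solve-∀

parkingCount : ℕ → ℕ → ℕ
parkingCount y zero    = 1
parkingCount y (suc p) = y * (y + suc p) ^ p

parkingCount-absorb : ∀ w p → (w + p) * parkingCount w p ≡ w * (w + p) ^ p
parkingCount-absorb w zero    = cong (_* 1) (+-identityʳ w)
parkingCount-absorb w (suc p) = x*[y*z]≡y*[x*z] (w + suc p) w ((w + suc p) ^ p)

-- Multiplied by M = z + m, each term becomes (z + r) M ^ s, which the binomial theorem sums.
abel-identity : ∀ z m → binomialSum m (λ r s → parkingCount (z + r) s) ≡ parkingCount (suc z) m
abel-identity z zero        = refl
abel-identity z m@(suc m′) =
  *-cancelʳ-≡ _ _ M {{M≢0}} (*-cancelʳ-≡ _ _ (suc M) (begin
    lhs * M * suc M
      ≡⟨ cong (_* suc M) scaled ⟩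
    (z * suc M ^ m + W) * suc M
      ≡⟨ *-distribʳ-+ (suc M) (z * suc M ^ m) W ⟩
    z * suc M ^ m * suc M + W * suc M
      ≡⟨ cong (z * suc M ^ m * suc M +_) (binomialSum-ones m M) ⟩
    z * suc M ^ m * suc M + m * suc M ^ m
      ≡⟨ collect z m′ (suc M ^ m′) ⟩
    parkingCount (suc z) m * M * suc M ∎))
  where
  open ≡-Reasoning
  M : ℕ
  M = z + m
  M≢0 : NonZero M
  M≢0 = subst NonZero (sym (+-suc z m′)) _
  lhs : ℕ
  lhs = binomialSum m (λ r s → parkingCount (z + r) s)
  term : ∀ r s → r + s ≡ m → M * parkingCount (z + r) s ≡ z * M ^ s + r * M ^ s
  term r s r+s≡m = begin
    M * parkingCount (z + r) s           ≡⟨ cong (_* parkingCount (z + r) s) M≡ ⟩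
    (z + r + s) * parkingCount (z + r) s ≡⟨ parkingCount-absorb (z + r) s ⟩
    (z + r) * (z + r + s) ^ s            ≡⟨ cong (λ x → (z + r) * x ^ s) (sym M≡) ⟩
    (z + r) * M ^ s                      ≡⟨ *-distribʳ-+ (M ^ s) z r ⟩
    z * M ^ s + r * M ^ s                ∎
    where
    M≡ : M ≡ z + r + s
    M≡ = trans (cong (z +_) (sym r+s≡m)) (sym (+-assoc z r s))
  W : ℕ
  W = binomialSum m (λ r s → r * M ^ s)
  scaled : lhs * M ≡ z * suc M ^ m + W
  scaled = begin
    lhs * M                                            ≡⟨ *-comm lhs M ⟩
    M * lhs                                            ≡⟨ binomialSum-* m M (λ r s → parkingCount (z + r) s) ⟨
    binomialSum m (λ r s → M * parkingCount (z + r) s) ≡⟨ binomialSum-cong m term ⟩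
    binomialSum m (λ r s → z * M ^ s + r * M ^ s)      ≡⟨ binomialSum-+ m (λ _ s → z * M ^ s) (λ r s → r * M ^ s) ⟩
    binomialSum m (λ _ s → z * M ^ s) + W              ≡⟨ cong (_+ W) (binomialSum-* m z (λ _ s → M ^ s)) ⟩
    z * binomialSum m (λ _ s → M ^ s) + W              ≡⟨ cong (λ x → z * x + W) (binomial-theorem m M) ⟩
    z * suc M ^ m + W                                  ∎
  collect : ∀ z m′ B → z * (suc (z + suc m′) * B) * suc (z + suc m′) + suc m′ * (suc (z + suc m′) * B) ≡
                       suc z * B * (z + suc m′) * suc (z + suc m′)
  collect = solve-∀

-- Sums over letters and words

sumOver : List ℕ → (ℕ → ℕ) → ℕ
sumOver []      f = 0
sumOver (x ∷ d) f = f x + sumOver d f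

sumOver-cong : ∀ d {f g : ℕ → ℕ} → (∀ {x} → x ∈ d → f x ≡ g x) → sumOver d f ≡ sumOver d g
sumOver-cong []      f≡g = refl
sumOver-cong (x ∷ d) f≡g = cong₂ _+_ (f≡g (here refl)) (sumOver-cong d (f≡g ∘ there))

sumOver-+ : ∀ d (f g : ℕ → ℕ) → sumOver d (λ x → f x + g x) ≡ sumOver d f + sumOver d g
sumOver-+ []      f g = refl
sumOver-+ (x ∷ d) f g = trans (cong (f x + g x +_) (sumOver-+ d f g)) (+-interchange (f x) (g x) _ _)

sumOver-* : ∀ d c (f : ℕ → ℕ) → sumOver d (λ x → c * f x) ≡ c * sumOver d f
sumOver-* []      c f = sym (*-zeroʳ c)
sumOver-* (x ∷ d) c f = trans (cong (c * f x +_) (sumOver-* d c f)) (sym (*-distribˡ-+ c (f x) _))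

sumOver-*ʳ : ∀ d (f : ℕ → ℕ) c → sumOver d f * c ≡ sumOver d (λ x → f x * c)
sumOver-*ʳ d f c = trans (*-comm (sumOver d f) c)
  (trans (sym (sumOver-* d c f)) (sumOver-cong d (λ {x} _ → *-comm c (f x))))

sumOver-zero : ∀ d → sumOver d (λ _ → 0) ≡ 0
sumOver-zero []      = refl
sumOver-zero (x ∷ d) = sumOver-zero d

sumOver-𝟙-none : ∀ d (P : ℕ → Bool) → (∀ {x} → x ∈ d → ¬ T (P x)) → sumOver d (𝟙 ∘ P) ≡ 0
sumOver-𝟙-none d P none = trans (sumOver-cong d (𝟙-false ∘ none)) (sumOver-zero d)

sumOver-comm : ∀ d e (h : ℕ → ℕ → ℕ) →
               sumOver d (λ x → sumOver e (h x)) ≡ sumOver e (λ y → sumOver d (λ x → h x y))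
sumOver-comm []      e h = sym (sumOver-zero e)
sumOver-comm (x ∷ d) e h = trans (cong (sumOver e (h x) +_) (sumOver-comm d e h))
                                 (sym (sumOver-+ e (h x) (λ y → sumOver d (λ x → h x y))))

sumOver-map : ∀ (g : ℕ → ℕ) d (f : ℕ → ℕ) → sumOver (map g d) f ≡ sumOver d (f ∘ g)
sumOver-map g []      f = refl
sumOver-map g (x ∷ d) f = cong (f (g x) +_) (sumOver-map g d f)

sumOver-binomialSum : ∀ d m (g : ℕ → ℕ → ℕ → ℕ) →
                      sumOver d (λ x → binomialSum m (g x)) ≡ binomialSum m (λ r s → sumOver d (λ x → g x r s))
sumOver-binomialSum d zero    g = refl
sumOver-binomialSum d (suc m) g = trans
  (sumOver-binomialSum d m (λ x r s → g x r (suc s) + g x (suc r) s))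
  (binomialSum-cong m (λ r s _ → sumOver-+ d (λ x → g x r (suc s)) (λ x → g x (suc r) s)))

sumOver-partition : ∀ (q : ℕ → Bool) d (f : ℕ → ℕ) →
                    sumOver d f ≡ sumOver (filterᵇ q d) f + sumOver (filterᵇ (not ∘ q) d) f
sumOver-partition q []      f = refl
sumOver-partition q (x ∷ d) f with q x
... | true  = trans (cong (f x +_) (sumOver-partition q d f)) (sym (+-assoc (f x) _ _))
... | false = trans (cong (f x +_) (sumOver-partition q d f)) (x+[y+z]≡y+[x+z] (f x) (sumOver (filterᵇ q d) f) _)

wordSum : List ℕ → ℕ → (List ℕ → ℕ) → ℕ
wordSum d zero    W = W []
wordSum d (suc m) W = sumOver d (λ x → wordSum d m (λ w → W (x ∷ w)))

wordSum-cong : ∀ d m {V W : List ℕ → ℕ} → (∀ w → All (_∈ d) w → length w ≡ m → V w ≡ W w) →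
               wordSum d m V ≡ wordSum d m W
wordSum-cong d zero    V≡W = V≡W [] [] refl
wordSum-cong d (suc m) V≡W = sumOver-cong d λ x∈d → wordSum-cong d m λ w w⊆d ∣w∣≡m →
  V≡W (_ ∷ w) (x∈d ∷ w⊆d) (cong suc ∣w∣≡m)

wordSum-* : ∀ d m c (W : List ℕ → ℕ) → wordSum d m (λ w → c * W w) ≡ c * wordSum d m W
wordSum-* d zero    c W = refl
wordSum-* d (suc m) c W = trans
  (sumOver-cong d (λ {x} _ → wordSum-* d m c (W ∘ (x ∷_))))
  (sumOver-* d c (λ x → wordSum d m (W ∘ (x ∷_))))

wordSum-zero : ∀ d m → wordSum d m (λ _ → 0) ≡ 0
wordSum-zero d zero    = refl
wordSum-zero d (suc m) = trans (sumOver-cong d (λ _ → wordSum-zero d m)) (sumOver-zero d)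

sumOver-wordSum : ∀ d e m (G : ℕ → List ℕ → ℕ) →
                  sumOver e (λ x → wordSum d m (G x)) ≡ wordSum d m (λ w → sumOver e (λ x → G x w))
sumOver-wordSum d e zero    G = refl
sumOver-wordSum d e (suc m) G = trans
  (sumOver-comm e d (λ x y → wordSum d m (G x ∘ (y ∷_))))
  (sumOver-cong d (λ {y} _ → sumOver-wordSum d e m (λ x → G x ∘ (y ∷_))))

wordSum-map : ∀ (g : ℕ → ℕ) d m (W : List ℕ → ℕ) → wordSum (map g d) m W ≡ wordSum d m (W ∘ map g)
wordSum-map g d zero    W = refl
wordSum-map g d (suc m) W = trans
  (sumOver-map g d (λ x → wordSum (map g d) m (W ∘ (x ∷_))))
  (sumOver-cong d (λ {y} _ → wordSum-map g d m (W ∘ (g y ∷_))))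

wordSum-length : ∀ d m (f : ℕ → ℕ) (W : List ℕ → ℕ) → wordSum d m (λ w → f (length w) * W w) ≡ f m * wordSum d m W
wordSum-length d zero    f W = refl
wordSum-length d (suc m) f W = trans
  (sumOver-cong d (λ {x} _ → wordSum-length d m (f ∘ suc) (W ∘ (x ∷_))))
  (sumOver-* d (f (suc m)) (λ x → wordSum d m (W ∘ (x ∷_))))

wordSum-singleton : ∀ x m (f : ℕ → ℕ) → wordSum (x ∷ []) m (f ∘ length) ≡ f m
wordSum-singleton x zero    f = refl
wordSum-singleton x (suc m) f = trans (+-identityʳ _) (wordSum-singleton x m (f ∘ suc))

wordSum-separable : ∀ d r e s (A B : List ℕ → ℕ) →
  wordSum d r (λ u → wordSum e s (λ v → A u * B v)) ≡ wordSum d r A * wordSum e s B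
wordSum-separable d r e s A B = begin
  wordSum d r (λ u → wordSum e s (λ v → A u * B v)) ≡⟨ wordSum-cong d r (λ u _ _ → wordSum-* e s (A u) B) ⟩
  wordSum d r (λ u → A u * wordSum e s B)           ≡⟨ wordSum-cong d r (λ u _ _ → *-comm (A u) _) ⟩
  wordSum d r (λ u → wordSum e s B * A u)           ≡⟨ wordSum-* d r (wordSum e s B) A ⟩
  wordSum e s B * wordSum d r A                     ≡⟨ *-comm (wordSum e s B) _ ⟩
  wordSum d r A * wordSum e s B                     ∎
  where open ≡-Reasoning

module _ (q : ℕ → Bool) where

  private
    filter-accepted : ∀ {x} l → T (q x) →
      filterᵇ q (x ∷ l) ≡ x ∷ filterᵇ q l × filterᵇ (not ∘ q) (x ∷ l) ≡ filterᵇ (not ∘ q) l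
    filter-accepted {x} l qx with q x
    ... | true = refl , refl

    filter-rejected : ∀ {x} l → T (not (q x)) →
      filterᵇ q (x ∷ l) ≡ filterᵇ q l × filterᵇ (not ∘ q) (x ∷ l) ≡ x ∷ filterᵇ (not ∘ q) l
    filter-rejected {x} l ¬qx with q x
    ... | false = refl , refl

  -- A word is determined by its q-part, its (not ∘ q)-part and the binary
  -- word recording which of its letters satisfy q.
  wordSum-partition : ∀ d m (F : List ℕ → List ℕ → ℕ) →
    wordSum d m (λ w → F (filterᵇ q w) (filterᵇ (not ∘ q) w)) ≡
    binomialSum m (λ r s → wordSum (filterᵇ q d) r (λ u → wordSum (filterᵇ (not ∘ q) d) s (F u)))
  wordSum-partition d zero    F = refl
  wordSum-partition d (suc m) F = begin
    sumOver d (λ x → wordSum d m (λ w → F (filterᵇ q (x ∷ w)) (filterᵇ (not ∘ q) (x ∷ w))))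
      ≡⟨ sumOver-partition q d _ ⟩
    sumOver D₁ (λ x → wordSum d m (λ w → F (filterᵇ q (x ∷ w)) (filterᵇ (not ∘ q) (x ∷ w)))) +
    sumOver D₀ (λ x → wordSum d m (λ w → F (filterᵇ q (x ∷ w)) (filterᵇ (not ∘ q) (x ∷ w))))
      ≡⟨ cong₂ _+_ (sumOver-cong D₁ λ x∈ → wordSum-cong d m λ w _ _ → accepted x∈ w)
                   (sumOver-cong D₀ λ x∈ → wordSum-cong d m λ w _ _ → rejected x∈ w) ⟩
    sumOver D₁ (λ x → wordSum d m (λ w → F (x ∷ filterᵇ q w) (filterᵇ (not ∘ q) w))) +
    sumOver D₀ (λ x → wordSum d m (λ w → F (filterᵇ q w) (x ∷ filterᵇ (not ∘ q) w)))
      ≡⟨ cong₂ _+_ (sumOver-cong D₁ λ {x} _ → wordSum-partition d m (F ∘ (x ∷_)))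
                   (sumOver-cong D₀ λ {x} _ → wordSum-partition d m (λ u w → F u (x ∷ w))) ⟩
    sumOver D₁ (λ x → binomialSum m (λ r s → wordSum D₁ r (λ u → wordSum D₀ s (F (x ∷ u))))) +
    sumOver D₀ (λ x → binomialSum m (λ r s → wordSum D₁ r (λ u → wordSum D₀ s (λ w → F u (x ∷ w)))))
      ≡⟨ cong₂ _+_ (sumOver-binomialSum D₁ m _) (sumOver-binomialSum D₀ m _) ⟩
    binomialSum m (λ r s → g (suc r) s) +
    binomialSum m (λ r s → sumOver D₀ (λ x → wordSum D₁ r (λ u → wordSum D₀ s (λ w → F u (x ∷ w)))))
      ≡⟨ cong (binomialSum m (λ r s → g (suc r) s) +_)
              (binomialSum-cong m λ r s _ → sumOver-wordSum D₁ D₀ r (λ x u → wordSum D₀ s (λ w → F u (x ∷ w)))) ⟩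
    binomialSum m (λ r s → g (suc r) s) + binomialSum m (λ r s → g r (suc s))
      ≡⟨ +-comm (binomialSum m (λ r s → g (suc r) s)) _ ⟩
    binomialSum m (λ r s → g r (suc s)) + binomialSum m (λ r s → g (suc r) s)
      ≡⟨ binomialSum-+ m (λ r s → g r (suc s)) (λ r s → g (suc r) s) ⟨
    binomialSum (suc m) g ∎
    where
    open ≡-Reasoning
    D₁ = filterᵇ q d
    D₀ = filterᵇ (not ∘ q) d
    g : ℕ → ℕ → ℕ
    g r s = wordSum D₁ r (λ u → wordSum D₀ s (F u))
    accepted : ∀ {x} → x ∈ D₁ → ∀ w →
      F (filterᵇ q (x ∷ w)) (filterᵇ (not ∘ q) (x ∷ w)) ≡ F (x ∷ filterᵇ q w) (filterᵇ (not ∘ q) w)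
    accepted x∈ w with filter-accepted w (proj₂ (∈-filter⁻ (T? ∘ q) {xs = d} x∈))
    ... | e₁ , e₀ = cong₂ F e₁ e₀
    rejected : ∀ {x} → x ∈ D₀ → ∀ w →
      F (filterᵇ q (x ∷ w)) (filterᵇ (not ∘ q) (x ∷ w)) ≡ F (filterᵇ q w) (x ∷ filterᵇ (not ∘ q) w)
    rejected x∈ w with filter-rejected w (proj₂ (∈-filter⁻ (T? ∘ (not ∘ q)) {xs = d} x∈))
    ... | e₁ , e₀ = cong₂ F e₁ e₀

range : ℕ → ℕ → List ℕ
range a zero    = []
range a (suc b) = suc a ∷ range (suc a) b

∈-range⁻ : ∀ a b {x} → x ∈ range a b → a < x × x ≤ a + b
∈-range⁻ a (suc b)     (here refl) = ≤-refl , subst (suc a ≤_) (sym (+-suc a b)) (s≤s (m≤m+n a b))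
∈-range⁻ a (suc b) {x} (there x∈)  with ∈-range⁻ (suc a) b x∈
... | a<x , x≤ = <-trans (n<1+n a) a<x , subst (x ≤_) (sym (+-suc a b)) x≤

∈-range⁺ : ∀ a b {x} → a < x → x ≤ a + b → x ∈ range a b
∈-range⁺ a zero    a<x x≤ = ⊥-elim (<⇒≱ a<x (subst (_ ≤_) (+-identityʳ a) x≤))
∈-range⁺ a (suc b) {x} a<x x≤ with x ≟ suc a
... | yes refl = here refl
... | no  x≢   = there (∈-range⁺ (suc a) b (≤∧≢⇒< a<x (x≢ ∘ sym)) (subst (x ≤_) (+-suc a b) x≤))

range-above : ∀ a b → All (a <_) (range a b)
range-above a b = All.tabulate (proj₁ ∘ ∈-range⁻ a b)

range-below : ∀ a b → All (_≤ a + b) (range a b)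
range-below a b = All.tabulate (proj₂ ∘ ∈-range⁻ a b)

Positive : List ℕ → Set
Positive = All (1 ≤_)

range-positive : ∀ b {w} → All (_∈ range 0 b) w → Positive w
range-positive b = All.map (proj₁ ∘ ∈-range⁻ 0 b)

map-+-range : ∀ c a b → map (c +_) (range a b) ≡ range (c + a) b
map-+-range c a zero    = refl
map-+-range c a (suc b) =
  cong₂ _∷_ (+-suc c a) (trans (map-+-range c (suc a) b) (cong (λ x → range x b) (+-suc c a)))

range-++ : ∀ a c e → range a (c + e) ≡ range a c ++ range (a + c) e
range-++ a zero    e = cong (λ x → range x e) (sym (+-identityʳ a))
range-++ a (suc c) e =
  cong (suc a ∷_) (trans (range-++ (suc a) c e) (cong (λ x → range (suc a) c ++ range x e) (sym (+-suc a c))))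

sumOver-range-𝟙-unique : ∀ a b (P : ℕ → Bool) {ℓ} → ℓ ∈ range a b → T (P ℓ) →
  (∀ {x} → x ∈ range a b → T (P x) → x ≡ ℓ) → sumOver (range a b) (𝟙 ∘ P) ≡ 1
sumOver-range-𝟙-unique a (suc b) P (here refl) Pℓ unique = cong₂ _+_ (𝟙-true Pℓ)
  (sumOver-𝟙-none (range (suc a) b) P λ x∈ Px →
    <-irrefl (sym (unique (there x∈) Px)) (proj₁ (∈-range⁻ (suc a) b x∈)))
sumOver-range-𝟙-unique a (suc b) P (there ℓ∈) Pℓ unique = cong₂ _+_
  (𝟙-false λ P1+a → <-irrefl (unique (here refl) P1+a) (proj₁ (∈-range⁻ (suc a) b ℓ∈)))
  (sumOver-range-𝟙-unique (suc a) b P ℓ∈ Pℓ (unique ∘ there))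

sumFromTo-range : ∀ m a b (f : ℕ → ℕ) → b ∸ a ≡ m → sumFromTo (suc a) b f ≡ sumOver (range a m) f
sumFromTo-range zero    a b f b∸a≡0 rewrite b∸a≡0 = refl
sumFromTo-range (suc m) a b f b∸a≡ =
  trans unfold (cong (f (suc a) +_) (sumFromTo-range m (suc a) b f b∸1+a≡))
  where
  b∸1+a≡ : b ∸ suc a ≡ m
  b∸1+a≡ = trans (sym (pred[m∸n]≡m∸[1+n] b a)) (cong pred b∸a≡)
  -- sumFromTo computes only once its number of terms, suc b ∸ a, is a numeral
  unfold : sumFromTo (suc a) b f ≡ f (suc a) + sumFromTo (suc (suc a)) b f
  unfold rewrite b∸a≡ | b∸1+a≡ = refl

atMost : ℕ → List ℕ → List ℕ
atMost ℓ = filterᵇ (_≤ᵇ ℓ)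

beyond : ℕ → List ℕ → List ℕ
beyond ℓ = filterᵇ (not ∘ (_≤ᵇ ℓ))

module _ {ℓ x : ℕ} (w : List ℕ) where

  atMost-∷-≤ : x ≤ ℓ → atMost ℓ (x ∷ w) ≡ x ∷ atMost ℓ w
  atMost-∷-≤ x≤ℓ = filter-accept (T? ∘ (_≤ᵇ ℓ)) {x} {w} (≤⇒≤ᵇ x≤ℓ)

  atMost-∷-> : ℓ < x → atMost ℓ (x ∷ w) ≡ atMost ℓ w
  atMost-∷-> ℓ<x = filter-reject (T? ∘ (_≤ᵇ ℓ)) {x} {w} (≤ᵇ-above ℓ<x)

  beyond-∷-≤ : x ≤ ℓ → beyond ℓ (x ∷ w) ≡ beyond ℓ w
  beyond-∷-≤ x≤ℓ = filter-reject (T? ∘ (not ∘ (_≤ᵇ ℓ))) {x} {w} (¬T-not (≤⇒≤ᵇ x≤ℓ))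

  beyond-∷-> : ℓ < x → beyond ℓ (x ∷ w) ≡ x ∷ beyond ℓ w
  beyond-∷-> ℓ<x = filter-accept (T? ∘ (not ∘ (_≤ᵇ ℓ))) {x} {w} (T-not (≤ᵇ-above ℓ<x))

atMost-range : ∀ ℓ e → atMost ℓ (range 0 (ℓ + e)) ≡ range 0 ℓ
atMost-range ℓ e = begin
  atMost ℓ (range 0 (ℓ + e))                   ≡⟨ cong (atMost ℓ) (range-++ 0 ℓ e) ⟩
  atMost ℓ (range 0 ℓ ++ range ℓ e)            ≡⟨ filter-++ (T? ∘ (_≤ᵇ ℓ)) (range 0 ℓ) (range ℓ e) ⟩
  atMost ℓ (range 0 ℓ) ++ atMost ℓ (range ℓ e) ≡⟨ cong₂ _++_ kept dropped ⟩
  range 0 ℓ ++ []                              ≡⟨ ++-identityʳ (range 0 ℓ) ⟩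
  range 0 ℓ                                    ∎
  where
  open ≡-Reasoning
  kept = filter-all (T? ∘ (_≤ᵇ ℓ)) (All.map ≤⇒≤ᵇ (range-below 0 ℓ))
  dropped = filter-none (T? ∘ (_≤ᵇ ℓ)) (All.map ≤ᵇ-above (range-above ℓ e))

beyond-range : ∀ ℓ e → beyond ℓ (range 0 (ℓ + e)) ≡ map (ℓ +_) (range 0 e)
beyond-range ℓ e = begin
  beyond ℓ (range 0 (ℓ + e))                   ≡⟨ cong (beyond ℓ) (range-++ 0 ℓ e) ⟩
  beyond ℓ (range 0 ℓ ++ range ℓ e)            ≡⟨ filter-++ (T? ∘ (not ∘ (_≤ᵇ ℓ))) (range 0 ℓ) (range ℓ e) ⟩
  beyond ℓ (range 0 ℓ) ++ beyond ℓ (range ℓ e) ≡⟨ cong₂ _++_ dropped kept ⟩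
  range ℓ e                                    ≡⟨ cong (λ a → range a e) (+-identityʳ ℓ) ⟨
  range (ℓ + 0) e                              ≡⟨ map-+-range ℓ 0 e ⟨
  map (ℓ +_) (range 0 e)                       ∎
  where
  open ≡-Reasoning
  dropped = filter-none (T? ∘ (not ∘ (_≤ᵇ ℓ))) (All.map (¬T-not ∘ ≤⇒≤ᵇ) (range-below 0 ℓ))
  kept = filter-all (T? ∘ (not ∘ (_≤ᵇ ℓ))) (All.map (T-not ∘ ≤ᵇ-above) (range-above ℓ e))

length-partition : ∀ (q : ℕ → Bool) w → length (filterᵇ q w) + length (filterᵇ (not ∘ q) w) ≡ length w
length-partition q []      = refl
length-partition q (x ∷ w) with q x
... | true  = cong suc (length-partition q w)
... | false = trans (+-suc _ _) (cong suc (length-partition q w))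

countAtMost : ℕ → List ℕ → ℕ
countAtMost t w = length (atMost t w)

module _ {t x : ℕ} (w : List ℕ) where

  countAtMost-∷-≤ : x ≤ t → countAtMost t (x ∷ w) ≡ suc (countAtMost t w)
  countAtMost-∷-≤ x≤t = cong length (atMost-∷-≤ w x≤t)

  countAtMost-∷-> : t < x → countAtMost t (x ∷ w) ≡ countAtMost t w
  countAtMost-∷-> t<x = cong length (atMost-∷-> w t<x)

  countAtMost-∷-lower : countAtMost t w ≤ countAtMost t (x ∷ w)
  countAtMost-∷-lower with x ≤? t
  ... | yes x≤t = ≤-trans (n≤1+n (countAtMost t w)) (≤-reflexive (sym (countAtMost-∷-≤ x≤t)))
  ... | no  x≰t = ≤-reflexive (sym (countAtMost-∷-> (≰⇒> x≰t)))

  countAtMost-∷-upper : countAtMost t (x ∷ w) ≤ suc (countAtMost t w)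
  countAtMost-∷-upper with x ≤? t
  ... | yes x≤t = ≤-reflexive (countAtMost-∷-≤ x≤t)
  ... | no  x≰t = ≤-trans (≤-reflexive (countAtMost-∷-> (≰⇒> x≰t))) (n≤1+n (countAtMost t w))

countAtMost-∷-cong : ∀ {t v} x w → countAtMost t v ≡ countAtMost t w →
                     countAtMost t (x ∷ v) ≡ countAtMost t (x ∷ w)
countAtMost-∷-cong {t} {v} x w v≡w with x ≤? t
... | yes x≤t = trans (countAtMost-∷-≤ v x≤t) (trans (cong suc v≡w) (sym (countAtMost-∷-≤ w x≤t)))
... | no  x≰t = trans (countAtMost-∷-> v (≰⇒> x≰t)) (trans v≡w (sym (countAtMost-∷-> w (≰⇒> x≰t))))

countAtMost-mono : ∀ {t t′} w → t ≤ t′ → countAtMost t w ≤ countAtMost t′ w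
countAtMost-mono []      _    = z≤n
countAtMost-mono {t} {t′} (x ∷ w) t≤t′ with x ≤? t
... | yes x≤t = begin
  countAtMost t (x ∷ w)  ≡⟨ countAtMost-∷-≤ w x≤t ⟩
  suc (countAtMost t w)  ≤⟨ s≤s (countAtMost-mono w t≤t′) ⟩
  suc (countAtMost t′ w) ≡⟨ countAtMost-∷-≤ w (≤-trans x≤t t≤t′) ⟨
  countAtMost t′ (x ∷ w) ∎
  where open ≤-Reasoning
... | no  x≰t = begin
  countAtMost t (x ∷ w)  ≡⟨ countAtMost-∷-> w (≰⇒> x≰t) ⟩
  countAtMost t w        ≤⟨ countAtMost-mono w t≤t′ ⟩
  countAtMost t′ w       ≤⟨ countAtMost-∷-lower {x = x} w ⟩
  countAtMost t′ (x ∷ w) ∎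
  where open ≤-Reasoning

countAtMost-all : ∀ {t w} → All (_≤ t) w → countAtMost t w ≡ length w
countAtMost-all {t} {w} w≤t = cong length (filter-all (T? ∘ (_≤ᵇ t)) (All.map ≤⇒≤ᵇ w≤t))

countAtMost-none : ∀ {t w} → All (t <_) w → countAtMost t w ≡ 0
countAtMost-none {t} w>t = cong length (filter-none (T? ∘ (_≤ᵇ t)) (All.map ≤ᵇ-above w>t))

countAtMost≡length⇒all : ∀ t w → countAtMost t w ≡ length w → All (_≤ t) w
countAtMost≡length⇒all t []      _ = []
countAtMost≡length⇒all t (x ∷ w) c≡ with x ≤? t
... | yes x≤t = x≤t ∷ countAtMost≡length⇒all t w (suc-injective (trans (sym (countAtMost-∷-≤ w x≤t)) c≡))
... | no  x≰t = ⊥-elim (<-irrefl refl (begin-strict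
  length w               <⟨ n<1+n (length w) ⟩
  suc (length w)         ≡⟨ c≡ ⟨
  countAtMost t (x ∷ w)  ≡⟨ countAtMost-∷-> w (≰⇒> x≰t) ⟩
  countAtMost t w        ≤⟨ length-filter (T? ∘ (_≤ᵇ t)) w ⟩
  length w               ∎))
  where open ≤-Reasoning

countAtMost-atMost : ∀ {t ℓ} w → t ≤ ℓ → countAtMost t (atMost ℓ w) ≡ countAtMost t w
countAtMost-atMost []      _   = refl
countAtMost-atMost {t} {ℓ} (x ∷ w) t≤ℓ with x ≤? ℓ
... | yes x≤ℓ rewrite atMost-∷-≤ w x≤ℓ = countAtMost-∷-cong x w (countAtMost-atMost w t≤ℓ)
... | no  x≰ℓ rewrite atMost-∷-> w (≰⇒> x≰ℓ) =
  trans (countAtMost-atMost w t≤ℓ) (sym (countAtMost-∷-> w (≤-<-trans t≤ℓ (≰⇒> x≰ℓ))))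

countAtMost-beyond : ∀ {t ℓ} w → ℓ ≤ t → countAtMost t w ≡ countAtMost ℓ w + countAtMost t (beyond ℓ w)
countAtMost-beyond []      _   = refl
countAtMost-beyond {t} {ℓ} (x ∷ w) ℓ≤t with x ≤? ℓ
... | yes x≤ℓ
  rewrite beyond-∷-≤ w x≤ℓ | countAtMost-∷-≤ w x≤ℓ | countAtMost-∷-≤ w (≤-trans x≤ℓ ℓ≤t) =
  cong suc (countAtMost-beyond w ℓ≤t)
... | no  x≰ℓ rewrite beyond-∷-> w (≰⇒> x≰ℓ) | countAtMost-∷-> w (≰⇒> x≰ℓ) with x ≤? t
...   | yes x≤t
  rewrite countAtMost-∷-≤ w x≤t | countAtMost-∷-≤ (beyond ℓ w) x≤t =
  trans (cong suc (countAtMost-beyond w ℓ≤t)) (sym (+-suc _ _))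
...   | no  x≰t
  rewrite countAtMost-∷-> w (≰⇒> x≰t) | countAtMost-∷-> (beyond ℓ w) (≰⇒> x≰t) =
  countAtMost-beyond w ℓ≤t

countAtMost-lower : ∀ s ℓ w → countAtMost s (map (_∸ ℓ) w) ≡ countAtMost (s + ℓ) w
countAtMost-lower s ℓ []      = refl
countAtMost-lower s ℓ (x ∷ w) with x ≤? s + ℓ
... | yes x≤s+ℓ = begin
  countAtMost s (x ∸ ℓ ∷ map (_∸ ℓ) w) ≡⟨ countAtMost-∷-≤ (map (_∸ ℓ) w) (m≤n+o⇒m∸n≤o x ℓ x≤ℓ+s) ⟩
  suc (countAtMost s (map (_∸ ℓ) w))   ≡⟨ cong suc (countAtMost-lower s ℓ w) ⟩
  suc (countAtMost (s + ℓ) w)          ≡⟨ countAtMost-∷-≤ w x≤s+ℓ ⟨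
  countAtMost (s + ℓ) (x ∷ w)          ∎
  where
  open ≡-Reasoning
  x≤ℓ+s = subst (x ≤_) (+-comm s ℓ) x≤s+ℓ
... | no  x≰s+ℓ = begin
  countAtMost s (x ∸ ℓ ∷ map (_∸ ℓ) w) ≡⟨ countAtMost-∷-> (map (_∸ ℓ) w) (m+n≤o⇒m≤o∸n (suc s) (≰⇒> x≰s+ℓ)) ⟩
  countAtMost s (map (_∸ ℓ) w)         ≡⟨ countAtMost-lower s ℓ w ⟩
  countAtMost (s + ℓ) w                ≡⟨ countAtMost-∷-> w (≰⇒> x≰s+ℓ) ⟨
  countAtMost (s + ℓ) (x ∷ w)          ∎
  where open ≡-Reasoning

countAtMost-↭ : ∀ t {w w′} → w ↭ w′ → countAtMost t w ≡ countAtMost t w′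
countAtMost-↭ t w↭w′ = ↭-length (filter-↭ (T? ∘ (_≤ᵇ t)) w↭w′)

-- Parking words

-- For positive w and y ≥ 1: w preceded by y − 1 ones is a parking function.
Parking : ℕ → List ℕ → Set
Parking y w = ∀ t → t < length w + y → t < countAtMost t w + y

parking? : ℕ → List ℕ → Bool
parking? y w = ⌊ map′ (λ parks t → parks {t}) (λ parks {t} → parks t)
                      (allUpTo? (λ t → t <? countAtMost t w + y) (length w + y)) ⌋

𝟙-parking? : ∀ {y w y′ w′} → (Parking y w ⇔ Parking y′ w′) → 𝟙 (parking? y w) ≡ 𝟙 (parking? y′ w′)
𝟙-parking? P⇔P′ = 𝟙-cong (mk⇔ (fromWitness ∘ Equivalence.to P⇔P′ ∘ toWitness)
                                (fromWitness ∘ Equivalence.from P⇔P′ ∘ toWitness))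

parking-[] : ∀ y → Parking y []
parking-[] y _ t< = t<

parking-1⇔ : ∀ w → Parking 1 w ⇔ (∀ t → t ≤ length w → t ≤ countAtMost t w)
parking-1⇔ w = mk⇔
  (λ parks t t≤ → m<1+n⇒m≤n (subst (t <_) (+-comm _ 1) (parks t (subst (t <_) (+-comm 1 _) (s≤s t≤)))))
  (λ parks t t< → subst (t <_) (+-comm 1 _) (s≤s (parks t (m<1+n⇒m≤n (subst (t <_) (+-comm _ 1) t<)))))

parking-bounded : ∀ {w} → Parking 1 w → All (_≤ length w) w
parking-bounded {w} parks = countAtMost≡length⇒all (length w) w
  (≤-antisym (length-filter (T? ∘ (_≤ᵇ length w)) w)
             (Equivalence.to (parking-1⇔ w) parks (length w) ≤-refl))

parking-↭ : ∀ {i w w′} → w ↭ w′ → Parking i w → Parking i w′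
parking-↭ {i} w↭w′ parks t t< = subst (λ c → t < c + i) (countAtMost-↭ t w↭w′)
  (parks t (subst (λ L → t < L + i) (sym (↭-length w↭w′)) t<))

¬parking-0 : ∀ {w} → Positive w → 1 ≤ length w → ¬ Parking 0 w
¬parking-0 {w} w⁺ 1≤∣w∣ parks = <-irrefl refl (begin-strict
  0                    <⟨ parks 0 (subst (0 <_) (sym (+-identityʳ (length w))) 1≤∣w∣) ⟩
  countAtMost 0 w + 0  ≡⟨ cong (_+ 0) (countAtMost-none w⁺) ⟩
  0                    ∎)
  where open ≤-Reasoning

isOne : ℕ → Bool
isOne x = x ≡ᵇ 1

¬isOne : ∀ {x} → 1 < x → ¬ T (isOne x)
¬isOne {x} 1<x x≡ᵇ1 = <-irrefl (sym (≡ᵇ⇒≡ x 1 x≡ᵇ1)) 1<x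

ones : List ℕ → List ℕ
ones = filterᵇ isOne

dropOnes : List ℕ → List ℕ
dropOnes w = map pred (filterᵇ (not ∘ isOne) w)

countAtMost-dropOnes : ∀ t {w} → Positive w →
                       countAtMost (suc t) w ≡ length (ones w) + countAtMost t (dropOnes w)
countAtMost-dropOnes t []                           = refl
countAtMost-dropOnes t {suc zero ∷ w} (_ ∷ w⁺)     = cong suc (countAtMost-dropOnes t w⁺)
countAtMost-dropOnes t {suc (suc x) ∷ w} (_ ∷ w⁺) with suc x ≤ᵇ t
... | true  = trans (cong suc (countAtMost-dropOnes t w⁺)) (sym (+-suc _ _))
... | false = countAtMost-dropOnes t w⁺

-- The ones of w join the z extra ones in front; removing spot 1 lowers the other entries.
parking-dropOnes : ∀ z {w} → Positive w → Parking (suc z) w ⇔ Parking (z + length (ones w)) (dropOnes w)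
parking-dropOnes z {w} w⁺ = mk⇔
  (λ parks t t< →
     s<s⁻¹ (subst (suc t <_) (counts t) (parks (suc t) (subst (suc t <_) (sym lengths) (s<s t<)))))
  λ where parks zero    _  → ≤-trans (s≤s z≤n) (m≤n+m (suc z) (countAtMost 0 w))
          parks (suc t) t< →
            subst (suc t <_) (sym (counts t)) (s<s (parks t (s<s⁻¹ (subst (suc t <_) lengths t<))))
  where
  r : ℕ
  r = length (ones w)
  rearrange : ∀ r c z → r + c + suc z ≡ suc (c + (z + r))
  rearrange = solve-∀
  lengths : length w + suc z ≡ suc (length (dropOnes w) + (z + r))
  lengths = begin
    length w + suc z
      ≡⟨ cong (_+ suc z) (length-partition isOne w) ⟨
    r + length (filterᵇ (not ∘ isOne) w) + suc z
      ≡⟨ cong (λ L → r + L + suc z) (length-map pred (filterᵇ (not ∘ isOne) w)) ⟨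
    r + length (dropOnes w) + suc z
      ≡⟨ rearrange r (length (dropOnes w)) z ⟩
    suc (length (dropOnes w) + (z + r)) ∎
    where open ≡-Reasoning
  counts : ∀ t → countAtMost (suc t) w + suc z ≡ suc (countAtMost t (dropOnes w) + (z + r))
  counts t = trans (cong (_+ suc z) (countAtMost-dropOnes t w⁺)) (rearrange r (countAtMost t (dropOnes w)) z)

𝟙-parking-dropOnes : ∀ z {w} → Positive w →
                     𝟙 (parking? (suc z) w) ≡ 𝟙 (parking? (z + length (ones w)) (dropOnes w))
𝟙-parking-dropOnes z {w} w⁺ = 𝟙-parking? {w = w} {w′ = dropOnes w} (parking-dropOnes z w⁺)

ones-range : ∀ B → ones (range 0 (suc B)) ≡ 1 ∷ []
ones-range B = cong (1 ∷_) (filter-none (T? ∘ isOne) (All.map ¬isOne (range-above 1 B)))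

notOnes-range : ∀ B → filterᵇ (not ∘ isOne) (range 0 (suc B)) ≡ map suc (range 0 B)
notOnes-range B = trans (filter-all (T? ∘ (not ∘ isOne)) (All.map (T-not ∘ ¬isOne) (range-above 1 B)))
                        (sym (map-+-range 1 0 B))

map-pred-suc : ∀ w → map pred (map suc w) ≡ w
map-pred-suc w = trans (sym (map-∘ w)) (map-id w)

ones-atMost : ∀ {ℓ} w → 1 ≤ ℓ → ones (atMost ℓ w) ≡ ones w
ones-atMost []      _   = refl
ones-atMost {ℓ} (x ∷ w) 1≤ℓ with x ≤? ℓ
... | yes x≤ℓ rewrite atMost-∷-≤ w x≤ℓ with isOne x
...   | true  = cong (x ∷_) (ones-atMost w 1≤ℓ)
...   | false = ones-atMost w 1≤ℓ
ones-atMost {ℓ} (x ∷ w) 1≤ℓ | no x≰ℓ rewrite atMost-∷-> w (≰⇒> x≰ℓ) =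
  trans (ones-atMost w 1≤ℓ) (sym (filter-reject (T? ∘ isOne) {x} {w} (¬isOne (≤-<-trans 1≤ℓ (≰⇒> x≰ℓ)))))

parkingWords : ℕ → ℕ → ℕ → ℕ
parkingWords y m B = wordSum (range 0 B) m (𝟙 ∘ parking? y)

parkingWords-byOnes : ∀ z m B (f : ℕ → ℕ) →
  wordSum (range 0 (suc B)) m (λ w → f (length (ones w)) * 𝟙 (parking? (suc z) w)) ≡
  binomialSum m (λ r s → f r * parkingWords (z + r) s B)
parkingWords-byOnes z m B f = begin
  wordSum D m (λ w → f (length (ones w)) * 𝟙 (parking? (suc z) w))
    ≡⟨ wordSum-cong D m (λ w w⊆D _ →
         cong (f (length (ones w)) *_) (𝟙-parking-dropOnes z (range-positive (suc B) w⊆D))) ⟩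
  wordSum D m (λ w → F (filterᵇ isOne w) (filterᵇ (not ∘ isOne) w))
    ≡⟨ wordSum-partition isOne D m F ⟩
  binomialSum m (λ r s → wordSum (ones D) r (λ u → wordSum (filterᵇ (not ∘ isOne) D) s (F u)))
    ≡⟨ cong₂ (λ D₁ D₀ → binomialSum m (λ r s → wordSum D₁ r (λ u → wordSum D₀ s (F u))))
             (ones-range B) (notOnes-range B) ⟩
  binomialSum m (λ r s → wordSum (1 ∷ []) r (λ u → wordSum (map suc (range 0 B)) s (F u)))
    ≡⟨ binomialSum-cong m (λ r s _ → wordSum-cong (1 ∷ []) r (λ u _ _ → lowered u s)) ⟩
  binomialSum m (λ r s → wordSum (1 ∷ []) r (λ u → f (length u) * parkingWords (z + length u) s B))
    ≡⟨ binomialSum-cong m (λ r s _ → wordSum-singleton 1 r (λ r → f r * parkingWords (z + r) s B)) ⟩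
  binomialSum m (λ r s → f r * parkingWords (z + r) s B) ∎
  where
  open ≡-Reasoning
  D = range 0 (suc B)
  F : List ℕ → List ℕ → ℕ
  F u v = f (length u) * 𝟙 (parking? (z + length u) (map pred v))
  lowered : ∀ u s → wordSum (map suc (range 0 B)) s (F u) ≡ f (length u) * parkingWords (z + length u) s B
  lowered u s = begin
    wordSum (map suc (range 0 B)) s (F u)
      ≡⟨ wordSum-* (map suc (range 0 B)) s (f (length u)) _ ⟩
    f (length u) * wordSum (map suc (range 0 B)) s (𝟙 ∘ parking? (z + length u) ∘ map pred)
      ≡⟨ cong (f (length u) *_) (wordSum-map suc (range 0 B) s _) ⟩
    f (length u) * wordSum (range 0 B) s (𝟙 ∘ parking? (z + length u) ∘ map pred ∘ map suc)
      ≡⟨ cong (f (length u) *_) (wordSum-cong (range 0 B) s λ v _ _ →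
           cong (𝟙 ∘ parking? (z + length u)) (map-pred-suc v)) ⟩
    f (length u) * parkingWords (z + length u) s B ∎

parking-count : ∀ B m y → m + y ≤ suc B → parkingWords y m B ≡ parkingCount y m
parking-count B zero y _ = 𝟙-true (fromWitness (parking-[] y))
parking-count B (suc m) zero _ = trans
  (wordSum-cong (range 0 B) (suc m) {V = 𝟙 ∘ parking? 0} {W = λ _ → 0} λ w w⊆B ∣w∣≡ → 𝟙-false
    (¬parking-0 (range-positive B w⊆B) (subst (1 ≤_) (sym ∣w∣≡) (s≤s z≤n)) ∘ toWitness))
  (wordSum-zero (range 0 B) (suc m))
parking-count zero (suc m) (suc z) (s≤s m+1+z≤0) with () ← subst (_≤ 0) (+-suc m z) m+1+z≤0
parking-count (suc B) (suc m) (suc z) m+y≤ = begin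
  parkingWords (suc z) (suc m) (suc B)
    ≡⟨ wordSum-cong (range 0 (suc B)) (suc m) {V = 𝟙 ∘ parking? (suc z)} (λ _ _ _ → sym (*-identityˡ _)) ⟩
  wordSum (range 0 (suc B)) (suc m) (λ w → 1 * 𝟙 (parking? (suc z) w))
    ≡⟨ parkingWords-byOnes z (suc m) B (λ _ → 1) ⟩
  binomialSum (suc m) (λ r s → 1 * parkingWords (z + r) s B)
    ≡⟨ binomialSum-cong (suc m) (λ r s r+s≡ →
         trans (*-identityˡ _) (parking-count B s (z + r) (bound r s r+s≡))) ⟩
  binomialSum (suc m) (λ r s → parkingCount (z + r) s)
    ≡⟨ abel-identity z (suc m) ⟩
  parkingCount (suc z) (suc m) ∎
  where
  open ≡-Reasoning
  bound : ∀ r s → r + s ≡ suc m → s + (z + r) ≤ suc B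
  bound r s r+s≡ = subst (_≤ suc B) (trans (cong (_+ z) (sym r+s≡)) (rearrange r s z))
                         (s≤s⁻¹ (subst (_≤ suc (suc B)) (+-suc (suc m) z) m+y≤))
    where
    rearrange : ∀ r s z → r + s + z ≡ s + (z + r)
    rearrange = solve-∀

parkingWords-withOnes : ∀ m k →
  wordSum (range 0 (suc m)) m (λ w → 𝟙 (length (ones w) ≡ᵇ k) * 𝟙 (parking? 1 w)) ≡
  binomial m k * parkingCount k (m ∸ k)
parkingWords-withOnes m k = begin
  wordSum (range 0 (suc m)) m (λ w → 𝟙 (length (ones w) ≡ᵇ k) * 𝟙 (parking? 1 w))
    ≡⟨ parkingWords-byOnes 0 m m (λ r → 𝟙 (r ≡ᵇ k)) ⟩
  binomialSum m (λ r s → 𝟙 (r ≡ᵇ k) * parkingWords r s m)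
    ≡⟨ binomialSum-select m k (λ r s → parkingWords r s m) ⟩
  binomial m k * parkingWords k (m ∸ k) m
    ≡⟨ counted ⟩
  binomial m k * parkingCount k (m ∸ k) ∎
  where
  open ≡-Reasoning
  counted : binomial m k * parkingWords k (m ∸ k) m ≡ binomial m k * parkingCount k (m ∸ k)
  counted with k ≤? m
  ... | yes k≤m = cong (binomial m k *_)
                       (parking-count m (m ∸ k) k (≤-trans (≤-reflexive (m∸n+n≡m k≤m)) (n≤1+n m)))
  ... | no  k≰m rewrite binomial-vanishes (≰⇒> k≰m) = refl

binomial-parkingCount : ∀ m k → 1 ≤ k →
  binomial (suc m) k * parkingCount k (suc m ∸ k) ≡ binomial m (k ∸ 1) * suc m ^ (suc m ∸ k)
binomial-parkingCount m (suc k) _ with k ≤? m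
... | no  k≰m rewrite binomial-vanishes (≰⇒> k≰m) | binomial-vanishes (m<n⇒m<1+n (≰⇒> k≰m)) = refl
... | yes k≤m =
  subst (λ M → binomial (suc M) (suc k) * parkingCount (suc k) (M ∸ k) ≡ binomial M k * suc M ^ (M ∸ k))
        (m+[n∸m]≡n k≤m) (closed (m ∸ k))
  where
  closed : ∀ p → binomial (suc (k + p)) (suc k) * parkingCount (suc k) (k + p ∸ k)
               ≡ binomial (k + p) k * suc (k + p) ^ (k + p ∸ k)
  closed p rewrite m+n∸m≡n k p with p
  ... | zero  rewrite +-identityʳ k = cong (_* 1) (trans (binomial-diag (suc k)) (sym (binomial-diag k)))
  ... | suc p = begin
    binomial (suc M) (suc k) * (suc k * suc M ^ p) ≡⟨ *-assoc (binomial (suc M) (suc k)) (suc k) _ ⟨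
    binomial (suc M) (suc k) * suc k * suc M ^ p   ≡⟨ cong (_* suc M ^ p) (binomial-absorb M k) ⟩
    binomial M k * suc M * suc M ^ p               ≡⟨ *-assoc (binomial M k) (suc M) _ ⟩
    binomial M k * (suc M * suc M ^ p)             ∎
    where
    open ≡-Reasoning
    M : ℕ
    M = k + suc p

parkingCount-1 : ∀ p → parkingCount 1 p ≡ (p + 1) ^ (p ∸ 1)
parkingCount-1 zero    = refl
parkingCount-1 (suc p) = trans (*-identityˡ _) (cong (_^ p) (+-comm 1 (suc p)))

-- Splitting at the breakpoint

first-failure : ∀ {P : ℕ → Set} → Decidable P → ∀ m →
  (∀ t → t ≤ m → P t) ⊎ ∃ λ ℓ → ℓ ≤ m × ¬ P ℓ × (∀ t → t < ℓ → P t)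
first-failure P? zero with P? 0
... | yes P0 = inj₁ λ { _ z≤n → P0 }
... | no ¬P0 = inj₂ (0 , z≤n , ¬P0 , λ _ ())
first-failure P? (suc m) with first-failure P? m
... | inj₂ (ℓ , ℓ≤m , ¬Pℓ , below) = inj₂ (ℓ , m≤n⇒m≤1+n ℓ≤m , ¬Pℓ , below)
... | inj₁ upToM with P? (suc m)
...   | no ¬P = inj₂ (suc m , ≤-refl , ¬P , λ t → upToM t ∘ s≤s⁻¹)
...   | yes P = inj₁ λ t t≤1+m → [ upToM t ∘ s≤s⁻¹ , (λ { refl → P }) ]′ (m≤n⇒m<n∨m≡n t≤1+m)

splitsAt? : ℕ → List ℕ → Bool
splitsAt? ℓ a =
  (length (atMost ℓ a) ≡ᵇ pred ℓ) ∧ (parking? 1 (atMost ℓ a) ∧ parking? 1 (map (_∸ ℓ) (beyond ℓ a)))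

module Breakpoint {n′ : ℕ} (a : List ℕ) (∣a∣≡n′ : length a ≡ n′) (a≤n : All (_≤ suc n′) a) where

  n : ℕ
  n = suc n′

  c : ℕ → ℕ
  c t = countAtMost t a

  -- ℓ is the spot left empty when the cars a park; a car preferring j ≤ ℓ fills it.
  Breaks : ℕ → Set
  Breaks ℓ = suc (c ℓ) ≡ ℓ × (∀ t → t < ℓ → t ≤ c t) × (∀ t → ℓ ≤ t → t ≤ n → t ≤ suc (c t))

  parking-∷⇔ : ∀ j → Parking 1 (j ∷ a) ⇔ (∀ t → t ≤ n → t ≤ countAtMost t (j ∷ a))
  parking-∷⇔ j rewrite sym ∣a∣≡n′ = parking-1⇔ (j ∷ a)

  breakpoint : ∀ {j} → Parking 1 (j ∷ a) → ∃ λ ℓ → j ≤ ℓ × ℓ ≤ n × Breaks ℓ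
  breakpoint {j} parks with first-failure (λ t → t ≤? c t) n
  ... | inj₁ upToN = ⊥-elim (<-irrefl refl (begin-strict
    n′  <⟨ n<1+n n′ ⟩
    n   ≤⟨ upToN n ≤-refl ⟩
    c n ≡⟨ trans (countAtMost-all a≤n) ∣a∣≡n′ ⟩
    n′  ∎))
    where open ≤-Reasoning
  ... | inj₂ (zero , _ , 0≰c0 , _) = ⊥-elim (0≰c0 z≤n)
  ... | inj₂ (suc ℓ′ , ℓ≤n , ℓ≰cℓ , below) = suc ℓ′ , j≤ℓ , ℓ≤n , cong suc cℓ≡ℓ′ , below , above
    where
    ℓ : ℕ
    ℓ = suc ℓ′
    cℓ≡ℓ′ : c ℓ ≡ ℓ′
    cℓ≡ℓ′ = ≤-antisym (s≤s⁻¹ (≰⇒> ℓ≰cℓ)) (≤-trans (below ℓ′ ≤-refl) (countAtMost-mono a (n≤1+n ℓ′)))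
    j≤ℓ : j ≤ ℓ
    j≤ℓ with j ≤? ℓ
    ... | yes j≤ℓ = j≤ℓ
    ... | no  j≰ℓ =
      ⊥-elim (ℓ≰cℓ (subst (ℓ ≤_) (countAtMost-∷-> a (≰⇒> j≰ℓ)) (Equivalence.to (parking-∷⇔ j) parks ℓ ℓ≤n)))
    above : ∀ t → ℓ ≤ t → t ≤ n → t ≤ suc (c t)
    above t _ t≤n = ≤-trans (Equivalence.to (parking-∷⇔ j) parks t t≤n) (countAtMost-∷-upper {x = j} a)

  breakpoint⇒parking : ∀ {j ℓ} → j ≤ ℓ → Breaks ℓ → Parking 1 (j ∷ a)
  breakpoint⇒parking {j} {ℓ} j≤ℓ (_ , below , above) = Equivalence.from (parking-∷⇔ j) parks
    where
    parks : ∀ t → t ≤ n → t ≤ countAtMost t (j ∷ a)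
    parks t t≤n with t <? ℓ
    ... | yes t<ℓ = ≤-trans (below t t<ℓ) (countAtMost-∷-lower {x = j} a)
    ... | no  t≮ℓ = subst (t ≤_) (sym (countAtMost-∷-≤ a (≤-trans j≤ℓ (≮⇒≥ t≮ℓ))))
                          (above t (≮⇒≥ t≮ℓ) t≤n)

  breakpoint-unique : ∀ {ℓ ℓ′} → Breaks ℓ → Breaks ℓ′ → ℓ ≡ ℓ′
  breakpoint-unique {ℓ} {ℓ′} (cℓ , below , _) (cℓ′ , below′ , _) with <-cmp ℓ ℓ′
  ... | tri< ℓ<ℓ′ _ _ = ⊥-elim (<-irrefl refl (subst (_≤ c ℓ) (sym cℓ) (below′ ℓ ℓ<ℓ′)))
  ... | tri≈ _ ℓ≡ℓ′ _ = ℓ≡ℓ′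
  ... | tri> _ _ ℓ′<ℓ = ⊥-elim (<-irrefl refl (subst (_≤ c ℓ′) (sym cℓ′) (below ℓ′ ℓ′<ℓ)))

  module _ {ℓ′ : ℕ} (cℓ≡ℓ′ : c (suc ℓ′) ≡ ℓ′) where

    private
      ℓ : ℕ
      ℓ = suc ℓ′
      high : List ℕ
      high = map (_∸ ℓ) (beyond ℓ a)

    atMost-parking⇔ : Parking 1 (atMost ℓ a) ⇔ (∀ t → t < ℓ → t ≤ c t)
    atMost-parking⇔ = mk⇔
      (λ parks t t<ℓ → subst (t ≤_) (countAtMost-atMost a (<⇒≤ t<ℓ))
         (Equivalence.to (parking-1⇔ (atMost ℓ a)) parks t (subst (t ≤_) (sym cℓ≡ℓ′) (s≤s⁻¹ t<ℓ))))
      (λ below → Equivalence.from (parking-1⇔ (atMost ℓ a)) λ t t≤cℓ →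
         let t<ℓ = s≤s (subst (t ≤_) cℓ≡ℓ′ t≤cℓ) in
         subst (t ≤_) (sym (countAtMost-atMost a (<⇒≤ t<ℓ))) (below t t<ℓ))

    private
      shifted : ∀ s → suc (c (s + ℓ)) ≡ countAtMost s high + ℓ
      shifted s = begin
        suc (c (s + ℓ))
          ≡⟨ cong suc (countAtMost-beyond a (m≤n+m ℓ s)) ⟩
        suc (c ℓ + countAtMost (s + ℓ) (beyond ℓ a))
          ≡⟨ cong (λ x → suc (x + countAtMost (s + ℓ) (beyond ℓ a))) cℓ≡ℓ′ ⟩
        suc (ℓ′ + countAtMost (s + ℓ) (beyond ℓ a))
          ≡⟨ cong (λ x → suc (ℓ′ + x)) (countAtMost-lower s ℓ (beyond ℓ a)) ⟨
        suc (ℓ′ + countAtMost s high)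
          ≡⟨ +-comm (suc ℓ′) _ ⟩
        countAtMost s high + ℓ ∎
        where open ≡-Reasoning

      ∣high∣+ℓ≡n : length high + ℓ ≡ n
      ∣high∣+ℓ≡n = begin
        length high + ℓ                   ≡⟨ cong (_+ ℓ) (length-map (_∸ ℓ) (beyond ℓ a)) ⟩
        length (beyond ℓ a) + suc ℓ′      ≡⟨ +-suc _ ℓ′ ⟩
        suc (length (beyond ℓ a) + ℓ′)    ≡⟨ cong suc (+-comm _ ℓ′) ⟩
        suc (ℓ′ + length (beyond ℓ a))    ≡⟨ cong (λ x → suc (x + length (beyond ℓ a))) cℓ≡ℓ′ ⟨
        suc (c ℓ + length (beyond ℓ a))   ≡⟨ cong suc (trans (length-partition (_≤ᵇ ℓ) a) ∣a∣≡n′) ⟩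
        n                                 ∎
        where open ≡-Reasoning

    beyond-parking⇔ : Parking 1 high ⇔ (∀ t → ℓ ≤ t → t ≤ n → t ≤ suc (c t))
    beyond-parking⇔ = mk⇔
      (λ parks t ℓ≤t t≤n → let s = t ∸ ℓ; t≡s+ℓ = sym (m∸n+n≡m ℓ≤t) in
         subst (λ t → t ≤ suc (c t)) (sym t≡s+ℓ) (subst (s + ℓ ≤_) (sym (shifted s))
           (+-monoˡ-≤ ℓ (Equivalence.to (parking-1⇔ high) parks s
             (+-cancelʳ-≤ ℓ s _ (subst₂ _≤_ t≡s+ℓ (sym ∣high∣+ℓ≡n) t≤n))))))
      (λ above → Equivalence.from (parking-1⇔ high) λ s s≤∣high∣ →
         +-cancelʳ-≤ ℓ s _ (subst (s + ℓ ≤_) (shifted s)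
           (above (s + ℓ) (m≤n+m ℓ s) (subst (s + ℓ ≤_) ∣high∣+ℓ≡n (+-monoˡ-≤ ℓ s≤∣high∣)))))

  splitsAt⇔breaks : ∀ {ℓ} → 0 < ℓ → T (splitsAt? ℓ a) ⇔ Breaks ℓ
  splitsAt⇔breaks {ℓ@(suc ℓ′)} _ = mk⇔ to from
    where
    sized lowParks highParks : Bool
    sized = length (atMost ℓ a) ≡ᵇ ℓ′
    lowParks = parking? 1 (atMost ℓ a)
    highParks = parking? 1 (map (_∸ ℓ) (beyond ℓ a))
    to : T (sized ∧ (lowParks ∧ highParks)) → Breaks ℓ
    to split with Equivalence.to (T-∧ {sized}) split
    ... | size , parks with Equivalence.to (T-∧ {lowParks}) parks
    ... | low , high = cong suc cℓ≡ℓ′ , Equivalence.to (atMost-parking⇔ cℓ≡ℓ′) (toWitness low)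
                                      , Equivalence.to (beyond-parking⇔ cℓ≡ℓ′) (toWitness high)
      where
      cℓ≡ℓ′ = ≡ᵇ⇒≡ (c ℓ) ℓ′ size
    from : Breaks ℓ → T (sized ∧ (lowParks ∧ highParks))
    from (1+cℓ≡ℓ , below , above) = Equivalence.from (T-∧ {sized}) (≡⇒≡ᵇ (c ℓ) ℓ′ cℓ≡ℓ′ ,
      Equivalence.from (T-∧ {lowParks}) (fromWitness (Equivalence.from (atMost-parking⇔ cℓ≡ℓ′) below) ,
                                          fromWitness (Equivalence.from (beyond-parking⇔ cℓ≡ℓ′) above)))
      where
      cℓ≡ℓ′ = suc-injective 1+cℓ≡ℓ

  splits-in-range : ∀ {i m x} → x ∈ range i m → T (splitsAt? x a) → i < x × Breaks x
  splits-in-range {i} {m} {x} x∈ splits = i<x , Equivalence.to (splitsAt⇔breaks (≤-<-trans z≤n i<x)) splits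
    where
    i<x : i < x
    i<x = proj₁ (∈-range⁻ i m x∈)

  𝟙-parking-∷ : ∀ i → i < n →
    𝟙 (parking? 1 (suc i ∷ a)) ≡ sumOver (range i (n ∸ i)) (λ ℓ → 𝟙 (splitsAt? ℓ a))
  𝟙-parking-∷ i i<n with T? (parking? 1 (suc i ∷ a))
  ... | no ¬parks = trans (𝟙-false ¬parks) (sym (sumOver-𝟙-none (range i (n ∸ i)) (λ ℓ → splitsAt? ℓ a)
    λ x∈ splits → let (i<x , breaks) = splits-in-range x∈ splits in
                  ¬parks (fromWitness (breakpoint⇒parking i<x breaks))))
  ... | yes parks with breakpoint (toWitness parks)
  ...   | ℓ , i<ℓ , ℓ≤n , breaks =
    trans (𝟙-true parks) (sym (sumOver-range-𝟙-unique i (n ∸ i) (λ ℓ → splitsAt? ℓ a)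
      (∈-range⁺ i (n ∸ i) i<ℓ (subst (ℓ ≤_) (sym (m+[n∸m]≡n (<⇒≤ i<n))) ℓ≤n))
      (Equivalence.from (splitsAt⇔breaks (≤-<-trans z≤n i<ℓ)) breaks)
      λ x∈ splits → breakpoint-unique (proj₂ (splits-in-range x∈ splits)) breaks))

map-∸-+ : ∀ ℓ w → map (_∸ ℓ) (map (ℓ +_) w) ≡ w
map-∸-+ ℓ w = trans (sym (map-∘ w)) (trans (map-cong (m+n∸m≡n ℓ) w) (map-id w))

atMost-parkingWords : ∀ {n} ℓ′ k → suc ℓ′ ≤ n →
  wordSum (atMost (suc ℓ′) (range 0 n)) ℓ′ (λ u → 𝟙 (length (ones u) ≡ᵇ k) * 𝟙 (parking? 1 u)) ≡
  binomial ℓ′ k * parkingCount k (ℓ′ ∸ k)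
atMost-parkingWords {n} ℓ′ k ℓ≤n = begin
  wordSum (atMost ℓ (range 0 n)) ℓ′ Low                ≡⟨ cong (λ d → wordSum (atMost ℓ (range 0 d)) ℓ′ Low) n≡ ⟩
  wordSum (atMost ℓ (range 0 (ℓ + (n ∸ ℓ)))) ℓ′ Low    ≡⟨ cong (λ d → wordSum d ℓ′ Low) (atMost-range ℓ (n ∸ ℓ)) ⟩
  wordSum (range 0 ℓ) ℓ′ Low                           ≡⟨ parkingWords-withOnes ℓ′ k ⟩
  binomial ℓ′ k * parkingCount k (ℓ′ ∸ k)              ∎
  where
  open ≡-Reasoning
  ℓ : ℕ
  ℓ = suc ℓ′
  n≡ = sym (m+[n∸m]≡n ℓ≤n)
  Low : List ℕ → ℕ
  Low u = 𝟙 (length (ones u) ≡ᵇ k) * 𝟙 (parking? 1 u)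

beyond-parkingWords : ∀ {ℓ n} → ℓ ≤ n →
  wordSum (beyond ℓ (range 0 n)) (n ∸ ℓ) (λ v → 𝟙 (parking? 1 (map (_∸ ℓ) v))) ≡ parkingCount 1 (n ∸ ℓ)
beyond-parkingWords {ℓ} {n} ℓ≤n = begin
  wordSum (beyond ℓ (range 0 n)) (n ∸ ℓ) High
    ≡⟨ cong (λ d → wordSum (beyond ℓ (range 0 d)) (n ∸ ℓ) High) (sym (m+[n∸m]≡n ℓ≤n)) ⟩
  wordSum (beyond ℓ (range 0 (ℓ + (n ∸ ℓ)))) (n ∸ ℓ) High
    ≡⟨ cong (λ d → wordSum d (n ∸ ℓ) High) (beyond-range ℓ (n ∸ ℓ)) ⟩
  wordSum (map (ℓ +_) (range 0 (n ∸ ℓ))) (n ∸ ℓ) High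
    ≡⟨ wordSum-map (ℓ +_) (range 0 (n ∸ ℓ)) (n ∸ ℓ) High ⟩
  wordSum (range 0 (n ∸ ℓ)) (n ∸ ℓ) (High ∘ map (ℓ +_))
    ≡⟨ wordSum-cong (range 0 (n ∸ ℓ)) (n ∸ ℓ) (λ v _ _ → cong (𝟙 ∘ parking? 1) (map-∸-+ ℓ v)) ⟩
  parkingWords 1 (n ∸ ℓ) (n ∸ ℓ)
    ≡⟨ parking-count (n ∸ ℓ) (n ∸ ℓ) 1 (≤-reflexive (+-comm (n ∸ ℓ) 1)) ⟩
  parkingCount 1 (n ∸ ℓ) ∎
  where
  open ≡-Reasoning
  High : List ℕ → ℕ
  High v = 𝟙 (parking? 1 (map (_∸ ℓ) v))

splitsAt-count : ∀ n′ ℓ′ k → suc ℓ′ ≤ suc n′ →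
  wordSum (range 0 (suc n′)) n′ (λ a → 𝟙 (splitsAt? (suc ℓ′) a) * 𝟙 (length (ones a) ≡ᵇ k)) ≡
  binomial n′ ℓ′ * (binomial ℓ′ k * parkingCount k (ℓ′ ∸ k) * parkingCount 1 (n′ ∸ ℓ′))
splitsAt-count n′ ℓ′ k ℓ≤n = begin
  wordSum D n′ (λ a → 𝟙 (splitsAt? ℓ a) * 𝟙 (length (ones a) ≡ᵇ k))
    ≡⟨ wordSum-cong D n′ (λ a _ _ → regroup a) ⟩
  wordSum D n′ (λ a → F (atMost ℓ a) (beyond ℓ a))
    ≡⟨ wordSum-partition (_≤ᵇ ℓ) D n′ F ⟩
  binomialSum n′ (λ r s → wordSum (atMost ℓ D) r (λ u → wordSum (beyond ℓ D) s (F u)))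
    ≡⟨ binomialSum-cong n′ (λ r s _ → separate r s) ⟩
  binomialSum n′ (λ r s → 𝟙 (r ≡ᵇ ℓ′) * (wordSum (atMost ℓ D) r Low * wordSum (beyond ℓ D) s High))
    ≡⟨ binomialSum-select n′ ℓ′ (λ r s → wordSum (atMost ℓ D) r Low * wordSum (beyond ℓ D) s High) ⟩
  binomial n′ ℓ′ * (wordSum (atMost ℓ D) ℓ′ Low * wordSum (beyond ℓ D) (n′ ∸ ℓ′) High)
    ≡⟨ cong (λ x → binomial n′ ℓ′ * (x * wordSum (beyond ℓ D) (n′ ∸ ℓ′) High)) (atMost-parkingWords ℓ′ k ℓ≤n) ⟩
  binomial n′ ℓ′ * (binomial ℓ′ k * parkingCount k (ℓ′ ∸ k) * wordSum (beyond ℓ D) (n′ ∸ ℓ′) High)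
    ≡⟨ cong (λ x → binomial n′ ℓ′ * (binomial ℓ′ k * parkingCount k (ℓ′ ∸ k) * x)) (beyond-parkingWords ℓ≤n) ⟩
  binomial n′ ℓ′ * (binomial ℓ′ k * parkingCount k (ℓ′ ∸ k) * parkingCount 1 (n′ ∸ ℓ′)) ∎
  where
  open ≡-Reasoning
  n ℓ : ℕ
  n = suc n′
  ℓ = suc ℓ′
  D : List ℕ
  D = range 0 n
  Low High : List ℕ → ℕ
  Low u = 𝟙 (length (ones u) ≡ᵇ k) * 𝟙 (parking? 1 u)
  High v = 𝟙 (parking? 1 (map (_∸ ℓ) v))
  F : List ℕ → List ℕ → ℕ
  F u v = 𝟙 (length u ≡ᵇ ℓ′) * Low u * High v
  regroup : ∀ a → 𝟙 (splitsAt? ℓ a) * 𝟙 (length (ones a) ≡ᵇ k) ≡ F (atMost ℓ a) (beyond ℓ a)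
  regroup a = begin
    𝟙 (sized ∧ (low ∧ high)) * 𝟙 (length (ones a) ≡ᵇ k)
      ≡⟨ cong (_* 𝟙 (length (ones a) ≡ᵇ k))
              (trans (𝟙-∧ sized (low ∧ high)) (cong (𝟙 sized *_) (𝟙-∧ low high))) ⟩
    𝟙 sized * (𝟙 low * 𝟙 high) * 𝟙 (length (ones a) ≡ᵇ k)
      ≡⟨ cong (λ os → 𝟙 sized * (𝟙 low * 𝟙 high) * 𝟙 (length os ≡ᵇ k)) (ones-atMost a (s≤s z≤n)) ⟨
    𝟙 sized * (𝟙 low * 𝟙 high) * 𝟙 (length (ones (atMost ℓ a)) ≡ᵇ k)
      ≡⟨ rearrange (𝟙 sized) (𝟙 low) (𝟙 high) _ ⟩
    F (atMost ℓ a) (beyond ℓ a) ∎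
    where
    sized low high : Bool
    sized = length (atMost ℓ a) ≡ᵇ ℓ′
    low = parking? 1 (atMost ℓ a)
    high = parking? 1 (map (_∸ ℓ) (beyond ℓ a))
    rearrange : ∀ s l h o → s * (l * h) * o ≡ s * (o * l) * h
    rearrange = solve-∀
  separate : ∀ r s → wordSum (atMost ℓ D) r (λ u → wordSum (beyond ℓ D) s (F u)) ≡
                     𝟙 (r ≡ᵇ ℓ′) * (wordSum (atMost ℓ D) r Low * wordSum (beyond ℓ D) s High)
  separate r s = begin
    wordSum (atMost ℓ D) r (λ u → wordSum (beyond ℓ D) s (F u))
      ≡⟨ wordSum-separable (atMost ℓ D) r (beyond ℓ D) s (λ u → 𝟙 (length u ≡ᵇ ℓ′) * Low u) High ⟩
    wordSum (atMost ℓ D) r (λ u → 𝟙 (length u ≡ᵇ ℓ′) * Low u) * wordSum (beyond ℓ D) s High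
      ≡⟨ cong (_* wordSum (beyond ℓ D) s High) (wordSum-length (atMost ℓ D) r (λ r → 𝟙 (r ≡ᵇ ℓ′)) Low) ⟩
    𝟙 (r ≡ᵇ ℓ′) * wordSum (atMost ℓ D) r Low * wordSum (beyond ℓ D) s High
      ≡⟨ *-assoc (𝟙 (r ≡ᵇ ℓ′)) _ _ ⟩
    𝟙 (r ≡ᵇ ℓ′) * (wordSum (atMost ℓ D) r Low * wordSum (beyond ℓ D) s High) ∎

parking-∷-withOnes-count : ∀ n′ i k → 1 ≤ i → i < suc n′ → 1 ≤ k →
  wordSum (range 0 (suc n′)) n′ (λ a → 𝟙 (parking? 1 (suc i ∷ a)) * 𝟙 (length (ones a) ≡ᵇ k)) ≡
  formula (suc n′) (suc i) k
parking-∷-withOnes-count n′ i k 1≤i i<n 1≤k = begin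
  wordSum D n′ (λ a → 𝟙 (parking? 1 (suc i ∷ a)) * withOnes a)
    ≡⟨ wordSum-cong D n′ (λ a a⊆D ∣a∣≡n′ →
         breakpoints a ∣a∣≡n′ (All.map (proj₂ ∘ ∈-range⁻ 0 n) a⊆D)) ⟩
  wordSum D n′ (λ a → sumOver R (λ ℓ → 𝟙 (splitsAt? ℓ a) * withOnes a))
    ≡⟨ sumOver-wordSum D R n′ (λ ℓ a → 𝟙 (splitsAt? ℓ a) * withOnes a) ⟨
  sumOver R (λ ℓ → wordSum D n′ (λ a → 𝟙 (splitsAt? ℓ a) * withOnes a))
    ≡⟨ sumOver-cong R summand ⟩
  sumOver R term
    ≡⟨ sumFromTo-range (n ∸ i) i n term refl ⟨
  formula n (suc i) k ∎
  where
  open ≡-Reasoning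
  n : ℕ
  n = suc n′
  D R : List ℕ
  D = range 0 n
  R = range i (n ∸ i)
  withOnes : List ℕ → ℕ
  withOnes a = 𝟙 (length (ones a) ≡ᵇ k)
  term : ℕ → ℕ
  term ℓ = ((n ∸ 1) C (ℓ ∸ 1)) * ((ℓ ∸ 2) C (k ∸ 1)) * (ℓ ∸ 1) ^ (ℓ ∸ 1 ∸ k)
             * (n ∸ ℓ + 1) ^ (n ∸ ℓ ∸ 1)
  breakpoints : ∀ a → length a ≡ n′ → All (_≤ n) a →
    𝟙 (parking? 1 (suc i ∷ a)) * withOnes a ≡ sumOver R (λ ℓ → 𝟙 (splitsAt? ℓ a) * withOnes a)
  breakpoints a ∣a∣≡n′ a≤n = trans (cong (_* withOnes a) (Breakpoint.𝟙-parking-∷ a ∣a∣≡n′ a≤n i i<n))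
                                   (sumOver-*ʳ R (λ ℓ → 𝟙 (splitsAt? ℓ a)) (withOnes a))
  summand-at : ∀ ℓ → 1 < ℓ → ℓ ≤ n → wordSum D n′ (λ a → 𝟙 (splitsAt? ℓ a) * withOnes a) ≡ term ℓ
  summand-at (suc zero) (s≤s ()) _
  summand-at ℓ@(suc ℓ′@(suc ℓ″)) _ ℓ≤n = begin
    wordSum D n′ (λ a → 𝟙 (splitsAt? ℓ a) * withOnes a)
      ≡⟨ splitsAt-count n′ ℓ′ k ℓ≤n ⟩
    binomial n′ ℓ′ * (binomial ℓ′ k * parkingCount k (ℓ′ ∸ k) * parkingCount 1 (n ∸ ℓ))
      ≡⟨ cong₂ (λ x y → binomial n′ ℓ′ * (x * y))
               (binomial-parkingCount ℓ″ k 1≤k) (parkingCount-1 (n ∸ ℓ)) ⟩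
    binomial n′ ℓ′ * (binomial ℓ″ (k ∸ 1) * ℓ′ ^ (ℓ′ ∸ k) * (n ∸ ℓ + 1) ^ (n ∸ ℓ ∸ 1))
      ≡⟨ reassociate (binomial n′ ℓ′) (binomial ℓ″ (k ∸ 1)) _ _ ⟩
    binomial n′ ℓ′ * binomial ℓ″ (k ∸ 1) * ℓ′ ^ (ℓ′ ∸ k) * (n ∸ ℓ + 1) ^ (n ∸ ℓ ∸ 1)
      ≡⟨ cong₂ (λ x y → x * y * ℓ′ ^ (ℓ′ ∸ k) * (n ∸ ℓ + 1) ^ (n ∸ ℓ ∸ 1))
               (binomial≡C n′ ℓ′) (binomial≡C ℓ″ (k ∸ 1)) ⟩
    term ℓ ∎
    where
    reassociate : ∀ a b c d → a * (b * c * d) ≡ a * b * c * d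
    reassociate = solve-∀
  summand : ∀ {ℓ} → ℓ ∈ R → wordSum D n′ (λ a → 𝟙 (splitsAt? ℓ a) * withOnes a) ≡ term ℓ
  summand {ℓ} ℓ∈R with ∈-range⁻ i (n ∸ i) ℓ∈R
  ... | i<ℓ , ℓ≤ = summand-at ℓ (≤-<-trans 1≤i i<ℓ) (subst (ℓ ≤_) (m+[n∸m]≡n (<⇒≤ i<n)) ℓ≤)

-- Sorting

boundedFrom⇒parking : ∀ i {w} → BoundedFrom i w → Positive w × Parking i w
boundedFrom⇒parking i []                          = [] , λ _ t< → t<
boundedFrom⇒parking i {x ∷ w} ((1≤x , x≤i) ∷ bounded) with boundedFrom⇒parking (suc i) bounded
... | w⁺ , parks = 1≤x ∷ w⁺ , parks∷
  where
  parks∷ : Parking i (x ∷ w)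
  parks∷ t t< with x ≤? t
  ... | yes x≤t = subst (t <_) (trans (+-suc _ i) (cong (_+ i) (sym (countAtMost-∷-≤ w x≤t))))
                        (parks t (subst (t <_) (sym (+-suc (length w) i)) t<))
  ... | no  x≰t = ≤-trans (≤-trans (≰⇒> x≰t) x≤i) (m≤n+m i _)

sorted-parking⇒boundedFrom : ∀ i {w} → AllPairs _≤_ w → Positive w → Parking i w → BoundedFrom i w
sorted-parking⇒boundedFrom i {[]}    _               _          _     = []
sorted-parking⇒boundedFrom i {x ∷ w} (x≤w ∷ sorted) (1≤x ∷ w⁺) parks =
  (1≤x , x≤i) ∷ sorted-parking⇒boundedFrom (suc i) sorted w⁺ parks′
  where
  x≤i : x ≤ i
  x≤i with x ≤? i
  ... | yes x≤i = x≤i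
  ... | no  x≰i = ⊥-elim (<-irrefl refl (begin-strict
    i                         <⟨ parks i (s≤s (m≤n+m i (length w))) ⟩
    countAtMost i (x ∷ w) + i ≡⟨ cong (_+ i) (countAtMost-∷-> w (≰⇒> x≰i)) ⟩
    countAtMost i w + i       ≡⟨ cong (_+ i) (countAtMost-none (All.map (<-≤-trans (≰⇒> x≰i)) x≤w)) ⟩
    i                         ∎))
    where open ≤-Reasoning
  parks′ : Parking (suc i) w
  parks′ t t< with x ≤? t
  ... | yes x≤t = subst (t <_) (trans (cong (_+ i) (countAtMost-∷-≤ w x≤t)) (sym (+-suc _ i)))
                        (parks t (subst (t <_) (+-suc (length w) i) t<))
  ... | no  x≰t = ≤-trans (s≤s (≤-trans (<⇒≤ (≰⇒> x≰t)) x≤i)) (m≤n+m (suc i) _)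

isPF⇔ : ∀ {n} (π : Vec ℕ n) → IsPF π ⇔ (Positive (toList π) × Parking 1 (toList π))
isPF⇔ π = mk⇔
  (λ bounded → let (w⁺ , parks) = boundedFrom⇒parking 1 bounded in
     All-resp-↭ sorted↭ w⁺ , parking-↭ sorted↭ parks)
  (λ (w⁺ , parks) → sorted-parking⇒boundedFrom 1 (Linked⇒AllPairs ≤-trans (sort-↗ w))
     (All-resp-↭ (↭-sym sorted↭) w⁺) (parking-↭ (↭-sym sorted↭) parks))
  where
  w : List ℕ
  w = toList π
  sorted↭ : sort w ↭ w
  sorted↭ = sort-↭ w

BoundedFrom-irrelevant : ∀ {i w} (p q : BoundedFrom i w) → p ≡ q
BoundedFrom-irrelevant []                 []                 = refl
BoundedFrom-irrelevant ((p₁ , p₂) ∷ p) ((q₁ , q₂) ∷ q) =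
  cong₂ _∷_ (cong₂ _,_ (≤-irrelevant p₁ q₁) (≤-irrelevant p₂ q₂)) (BoundedFrom-irrelevant p q)

-- Word sums as cardinalities

T↔Fin𝟙 : ∀ b → T b ↔ Fin (𝟙 b)
T↔Fin𝟙 true  = ↔-sym 1↔⊤
T↔Fin𝟙 false = ↔-sym 0↔⊥

Σ-split : ∀ {F : ℕ → Set} a → (∀ {x} → F x → a < x) → Σ ℕ F ↔ (F (suc a) ⊎ Σ ℕ (λ x → suc a < x × F x))
Σ-split {F} a above = mk↔ₛ′ to from to∘from from∘to
  where
  to : Σ ℕ F → F (suc a) ⊎ Σ ℕ (λ x → suc a < x × F x)
  to (x , y) with x ≟ suc a
  ... | yes refl = inj₁ y
  ... | no  x≢   = inj₂ (x , ≤∧≢⇒< (above y) (x≢ ∘ sym) , y)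
  from : F (suc a) ⊎ Σ ℕ (λ x → suc a < x × F x) → Σ ℕ F
  from (inj₁ y)           = suc a , y
  from (inj₂ (x , _ , y)) = x , y
  to∘from : ∀ z → to (from z) ≡ z
  to∘from (inj₁ y) with suc a ≟ suc a
  ... | yes refl = refl
  ... | no  ≢    = ⊥-elim (≢ refl)
  to∘from (inj₂ (x , 1+a<x , y)) with x ≟ suc a
  ... | yes refl = ⊥-elim (<-irrefl refl 1+a<x)
  ... | no  _    = cong (λ p → inj₂ (x , p , y)) (<-irrelevant _ _)
  from∘to : ∀ z → from (to z) ≡ z
  from∘to (x , y) with x ≟ suc a
  ... | yes refl = refl
  ... | no  _    = refl

Σ-range↔ : ∀ a b {F : ℕ → Set} (f : ℕ → ℕ) → (∀ {x} → F x → x ∈ range a b) →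
           (∀ {x} → x ∈ range a b → F x ↔ Fin (f x)) → Σ ℕ F ↔ Fin (sumOver (range a b) f)
Σ-range↔ a zero    f inRange _ =
  mk↔ₛ′ (λ (_ , y) → case inRange y of λ ()) (λ ()) (λ ()) (λ (_ , y) → case inRange y of λ ())
Σ-range↔ a (suc b) {F} f inRange iso = ↔-trans (Σ-split a (proj₁ ∘ ∈-range⁻ a (suc b) ∘ inRange))
  (↔-trans (iso (here refl) ⊎-↔ Σ-range↔ (suc a) b f inRange′ iso′) (↔-sym +↔⊎))
  where
  inRange′ : ∀ {x} → suc a < x × F x → x ∈ range (suc a) b
  inRange′ (1+a<x , y) with inRange y
  ... | here refl = ⊥-elim (<-irrefl refl 1+a<x)
  ... | there x∈  = x∈
  iso′ : ∀ {x} → x ∈ range (suc a) b → (suc a < x × F x) ↔ Fin (f x)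
  iso′ {x} x∈ =
    ↔-trans (mk↔ₛ′ proj₂ (1+a<x ,_) (λ _ → refl) (λ (p , _) → cong (_, _) (<-irrelevant 1+a<x p)))
            (iso (there x∈))
    where
    1+a<x : suc a < x
    1+a<x = proj₁ (∈-range⁻ (suc a) b x∈)

Σ-Vec-∷ : ∀ {m} (G : Vec ℕ (suc m) → Set) → Σ (Vec ℕ (suc m)) G ↔ Σ ℕ (λ x → Σ (Vec ℕ m) (G ∘ (x ∷_)))
Σ-Vec-∷ G =
  mk↔ₛ′ (λ { (x ∷ v , p) → x , v , p }) (λ (x , v , p) → x ∷ v , p) (λ _ → refl) λ { (_ ∷ _ , _) → refl }

words↔ : ∀ m a b (P : List ℕ → Bool) → (∀ {w} → length w ≡ m → T (P w) → All (_∈ range a b) w) →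
         Σ (Vec ℕ m) (T ∘ P ∘ toList) ↔ Fin (wordSum (range a b) m (𝟙 ∘ P))
words↔ zero    a b P inRange =
  ↔-trans (mk↔ₛ′ (λ { ([] , p) → p }) ([] ,_) (λ _ → refl) λ { ([] , _) → refl }) (T↔Fin𝟙 (P []))
words↔ (suc m) a b P inRange = ↔-trans (Σ-Vec-∷ (T ∘ P ∘ toList))
  (Σ-range↔ a b (λ x → wordSum (range a b) m (𝟙 ∘ P ∘ (x ∷_)))
     (λ (v , p) → All.head (inRange (cong suc (length-toList v)) p))
     λ {x} _ → words↔ m a b (P ∘ (x ∷_)) (λ ∣w∣≡m → All.tail ∘ inRange (cong suc ∣w∣≡m)))

-- Both sides branch on x ≡ᵇ 1, to which does (x ≟ 1) reduces.
count-ones : ∀ {m} (v : Vec ℕ m) → count (_≟ 1) v ≡ length (ones (toList v))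
count-ones []      = refl
count-ones (x ∷ v) with x ≡ᵇ 1
... | true  = cong suc (count-ones v)
... | false = count-ones v

N₁-∷ : ∀ {m j} (v : Vec ℕ m) → 1 < j → N₁ (j ∷ v) ≡ length (ones (toList v))
N₁-∷ {j = suc zero}    v (s≤s ())
N₁-∷ {j = suc (suc _)} v _ = count-ones v

tailCondition? : ℕ → ℕ → List ℕ → Bool
tailCondition? j k a = all (1 ≤ᵇ_) a ∧ (parking? 1 (j ∷ a) ∧ (length (ones a) ≡ᵇ k))

tailCondition⇔ : ∀ j k a → T (tailCondition? j k a) ⇔ (Positive a × Parking 1 (j ∷ a) × length (ones a) ≡ k)
tailCondition⇔ j k a = mk⇔
  (λ ok → let (a⁺ , rest) = Equivalence.to (T-∧ {allPositive}) ok
              (parks , ones≡k) = Equivalence.to (T-∧ {parks?}) rest in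
     All.map (≤ᵇ⇒≤ 1 _) (all⁺ (1 ≤ᵇ_) a a⁺) , toWitness parks , ≡ᵇ⇒≡ _ k ones≡k)
  (λ (a⁺ , parks , ones≡k) → Equivalence.from (T-∧ {allPositive})
     (all⁻ (1 ≤ᵇ_) (All.map ≤⇒≤ᵇ a⁺) , Equivalence.from (T-∧ {parks?}) (fromWitness parks , ≡⇒≡ᵇ _ k ones≡k)))
  where
  allPositive parks? : Bool
  allPositive = all (1 ≤ᵇ_) a
  parks? = parking? 1 (j ∷ a)

PFjk↔tails : ∀ n′ j k → 1 < j → PFjk (suc n′) j k ↔ Σ (Vec ℕ n′) (T ∘ tailCondition? j k ∘ toList)
PFjk↔tails n′ j k 1<j = mk↔ₛ′ to from (λ (v , _) → cong (v ,_) (T-irrelevant _ _)) from∘to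
  where
  to : PFjk (suc n′) j k → Σ (Vec ℕ n′) (T ∘ tailCondition? j k ∘ toList)
  to (j ∷ v , isPF , refl , N₁≡k) = let (π⁺ , parks) = Equivalence.to (isPF⇔ (j ∷ v)) isPF in
    v , Equivalence.from (tailCondition⇔ j k (toList v)) (All.tail π⁺ , parks , trans (sym (N₁-∷ v 1<j)) N₁≡k)
  from : Σ (Vec ℕ n′) (T ∘ tailCondition? j k ∘ toList) → PFjk (suc n′) j k
  from (v , ok) = let (v⁺ , parks , ones≡k) = Equivalence.to (tailCondition⇔ j k (toList v)) ok in
    j ∷ v , Equivalence.from (isPF⇔ (j ∷ v)) (<⇒≤ 1<j ∷ v⁺ , parks) , refl , trans (N₁-∷ v 1<j) ones≡k
  from∘to : ∀ π → from (to π) ≡ π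
  from∘to (j ∷ v , isPF , refl , N₁≡k) =
    cong₂ (λ p q → j ∷ v , p , refl , q) (BoundedFrom-irrelevant _ _) (≡-irrelevant _ _)

tailCondition-inRange : ∀ n′ j k {a} → length a ≡ n′ → T (tailCondition? j k a) → All (_∈ range 0 (suc n′)) a
tailCondition-inRange n′ j k {a} refl ok = let (a⁺ , parks , _) = Equivalence.to (tailCondition⇔ j k a) ok in
  All.zipWith (λ (1≤x , x≤n) → ∈-range⁺ 0 (suc n′) 1≤x x≤n) (a⁺ , All.tail (parking-bounded {j ∷ a} parks))

tailCondition-count : ∀ n′ j k → 1 < j → j ≤ suc n′ → 1 ≤ k →
  wordSum (range 0 (suc n′)) n′ (𝟙 ∘ tailCondition? j k) ≡ formula (suc n′) j k
tailCondition-count n′ (suc i) k (s≤s 1≤i) j≤n 1≤k =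
  trans (wordSum-cong D n′ λ a a⊆D _ → positive-dropped a a⊆D) (parking-∷-withOnes-count n′ i k 1≤i j≤n 1≤k)
  where
  D = range 0 (suc n′)
  positive-dropped : ∀ a → All (_∈ D) a →
    𝟙 (tailCondition? (suc i) k a) ≡ 𝟙 (parking? 1 (suc i ∷ a)) * 𝟙 (length (ones a) ≡ᵇ k)
  positive-dropped a a⊆D = begin
    𝟙 (all (1 ≤ᵇ_) a ∧ (parks ∧ withOnes))   ≡⟨ 𝟙-∧ (all (1 ≤ᵇ_) a) (parks ∧ withOnes) ⟩
    𝟙 (all (1 ≤ᵇ_) a) * 𝟙 (parks ∧ withOnes) ≡⟨ cong (_* 𝟙 (parks ∧ withOnes)) (𝟙-true allPositive) ⟩
    1 * 𝟙 (parks ∧ withOnes)                 ≡⟨ *-identityˡ _ ⟩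
    𝟙 (parks ∧ withOnes)                     ≡⟨ 𝟙-∧ parks withOnes ⟩
    𝟙 parks * 𝟙 withOnes                     ∎
    where
    open ≡-Reasoning
    parks = parking? 1 (suc i ∷ a)
    withOnes = length (ones a) ≡ᵇ k
    allPositive = all⁻ (1 ≤ᵇ_) (All.map ≤⇒≤ᵇ (range-positive (suc n′) a⊆D))

proposition2p6 : (n j k : ℕ) → 2 ≤ j → j ≤ n → 1 ≤ k → k ≤ n ∸ 1 →
    PFjk n j k ↔ Fin (formula n j k)
proposition2p6 zero      _ _ 2≤j z≤n _   _ = case 2≤j of λ ()
proposition2p6 (suc n′) j k 1<j j≤n 1≤k _ =
  ↔-trans (PFjk↔tails n′ j k 1<j)
    (subst (λ N → Σ (Vec ℕ n′) (T ∘ tailCondition? j k ∘ toList) ↔ Fin N)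
           (tailCondition-count n′ j k 1<j j≤n 1≤k)
           (words↔ n′ 0 (suc n′) (tailCondition? j k) (tailCondition-inRange n′ j k)))
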